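{- Let $(R_S,C_S)$ be the $2n\times2n$ game defined in the context, and define $2n\times2n$ matrices $\tilde R_S,\tilde C_S$ by, for all $i\in[2n]$ and $j\in[n]$, $\tilde R_S(i,j)=(R_S(i,n+j)+3)/6$, $\tilde R_S(i,n+j)=(R_S(i,j)+3)/6$, $\tilde C_S(i,j)=(C_S(i,n+j)+3)/6$, $\tilde C_S(i,n+j)=(C_S(i,j)+3)/6$. Then for every $\varepsilon\in[0,1/26)$, with $\tau=102$ and $c=1/2$, the game $(\tilde R_S,\tilde C_S)$ is $(\varepsilon,\tau,c)$-enumeration-hard with respect to $S$ (viewing $S\subseteq[n]\subseteq[2n]$, $K=2n$).
   Context: Let $l\ge2$ be even, $n=\binom{l}{l/2}$, and $S\subseteq[n]$ with $|S|=l$. Fix an enumeration $S_1,\dots,S_n$ of the $(l/2)$-element subsets of $S$. Define $n\times n$ matrices $A_S,B_S$: for each column $j\in[n]$, $A_S(i,j)=-1,B_S(i,j)=1$ if $i\notin S$; $A_S(i,j)=1,B_S(i,j)=0$ if $i\in S\cap S_j$; $A_S(i,j)=0,B_S(i,j)=1$ if $i\in S\setminus S_j$. Define $$R_S=\begin{pmatrix}2J+A_S & -2J\\ -2J & 2J+B_S^\top\end{pmatrix},\qquad C_S=\begin{pmatrix}-2J+B_S & 2J\\ 2J & -2J+A_S^\top\end{pmatrix},$$ with $J$ the $n\times n$ all-ones matrix. For a game $(R,C)$ on $K$ strategies, mixed strategies lie in $\Delta_K=\{x\in[0,1]^K:\sum x_i=1\}$, $e_i$ is the $i$-th pure strategy;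 $(x,y)$ is an $\varepsilon$-WNE if $x_i>0\Rightarrow e_i^\top Ry\ge\max_ke_k^\top Ry-\varepsilon$ and $y_j>0\Rightarrow x^\top Ce_j\ge\max_kx^\top Ce_k-\varepsilon$. $\mathrm{supp}(v)$ is the set of nonzero coordinates. For $S\subseteq[K]$ and $m\le K$, $u_{m,S}\in\mathbb{R}^m$ has $i$-th coordinate $1/|S|$ if $i\in S$ and $0$ otherwise. For $\tau>0$, $\varepsilon,c\in[0,1]$ with $cK$ an integer and $S\subseteq[K]$, a game $(R',C')$ with $R',C'\in[-1,1]^{K\times K}$ is $(\varepsilon,\tau,c)$-enumeration-hard w.r.t. $S$ if (1) for every $y\in\Delta_K$ some $i$ has $e_i^\top R'y\ge1/2$, and for every $x\in\Delta_K$ some $j$ has $x^\top C'e_j\ge1/2$; (2) for every $\varepsilon$-WNE $(x,y)$, with $\tilde x=(x_1,\dots,x_{cK})$, $\tilde y=(y_1,\dots,y_{cK})$: (a) $\mathrm{supp}(\tilde x),\mathrm{supp}(\tilde y)\subseteq S$; (b) $\|\tilde x-c\,u_{cK,S}\|_1\le\tau\varepsilon$ and $\|\tilde y-c\,u_{cK,S}\|_1\le\tau\varepsilon$.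
   Formalization: The tolerance ε ranges over the rationals in $[0,1/26)$, and the mixed strategies in the enumeration-hardness conditions (the y in (1) and the ε-WNE pairs (x,y) in (2)) have rational coordinates. -}

module Defs where

open import Data.Nat as ℕ using (ℕ; zero; suc)
open import Data.Fin using (Fin; toℕ; splitAt; _↑ˡ_; _↑ʳ_)
open import Data.Fin.Subset using (Subset; _⊆_; ∣_∣; outside)
open import Data.Vec using (Vec; lookup; _++_; replicate)
open import Data.Bool using (Bool; true; false; if_then_else_)
open import Data.Sum using (_⊎_; inj₁; inj₂)
open import Data.Product using (Σ; ∃; _×_; _,_)
open import Data.Integer using (+_)
open import Data.Rational
  using (ℚ; 0ℚ; 1ℚ; _+_; _*_; _-_; -_; _≤_; _<_; _/_) renaming (∣_∣ to abs)
open import Relation.Binary.PropositionalEquality using (_≡_; _≢_)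

2ℚ 3ℚ : ℚ
2ℚ = + 2 / 1
3ℚ = + 3 / 1

ℕ→ℚ : ℕ → ℚ
ℕ→ℚ k = + k / 1

-- 1/k, with the (irrelevant here) convention 1/0 = 0
inv : ℕ → ℚ
inv zero    = 0ℚ
inv (suc k) = + 1 / suc k

Σᶠ : (K : ℕ) → (Fin K → ℚ) → ℚ
Σᶠ zero    f = 0ℚ
Σᶠ (suc K) f = f Fin.zero + Σᶠ K (λ i → f (Fin.suc i))
  where import Data.Fin as Fin

Σ<ᶠ : (K k : ℕ) → (Fin K → ℚ) → ℚ
Σ<ᶠ K k f = Σᶠ K (λ i → if toℕ i ℕ.<ᵇ k then f i else 0ℚ)

Mat : ℕ → Set
Mat K = Fin K → Fin K → ℚ

mem : ∀ {n} → Subset n → Fin n → Bool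
mem S i = lookup S i

module Construction (n : ℕ) (S : Subset n) (T : Fin n → Subset n) where

  A B : Mat n
  A i j = if mem S i then (if mem (T j) i then 1ℚ else 0ℚ) else (- 1ℚ)
  B i j = if mem S i then (if mem (T j) i then 0ℚ else 1ℚ) else 1ℚ

  R C : Mat (n ℕ.+ n)
  R i j with splitAt n i | splitAt n j
  ... | inj₁ a | inj₁ b = 2ℚ + A a b
  ... | inj₁ a | inj₂ b = - 2ℚ
  ... | inj₂ a | inj₁ b = - 2ℚ
  ... | inj₂ a | inj₂ b = 2ℚ + B b a
  C i j with splitAt n i | splitAt n j
  ... | inj₁ a | inj₁ b = (- 2ℚ) + B a b
  ... | inj₁ a | inj₂ b = 2ℚ
  ... | inj₂ a | inj₁ b = 2ℚ
  ... | inj₂ a | inj₂ b = (- 2ℚ) + A b a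

  swapHalf : Fin (n ℕ.+ n) → Fin (n ℕ.+ n)
  swapHalf j with splitAt n j
  ... | inj₁ b = n ↑ʳ b
  ... | inj₂ b = b ↑ˡ n

  R̃ C̃ : Mat (n ℕ.+ n)
  R̃ i j = (R i (swapHalf j) + 3ℚ) * (+ 1 / 6)
  C̃ i j = (C i (swapHalf j) + 3ℚ) * (+ 1 / 6)

embed : ∀ {n} → Subset n → Subset (n ℕ.+ n)
embed {n} S = S ++ replicate n outside

Simplex : (K : ℕ) → (Fin K → ℚ) → Set
Simplex K x = (∀ i → 0ℚ ≤ x i) × Σᶠ K x ≡ 1ℚ

rowPay : ∀ {K} → Mat K → (Fin K → ℚ) → Fin K → ℚ
rowPay {K} R y i = Σᶠ K (λ j → R i j * y j)

colPay : ∀ {K} → Mat K → (Fin K → ℚ) → Fin K → ℚ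
colPay {K} C x j = Σᶠ K (λ i → x i * C i j)

IsWNE : ∀ {K} → Mat K → Mat K → ℚ → (Fin K → ℚ) → (Fin K → ℚ) → Set
IsWNE {K} R C ε x y =
  Simplex K x × Simplex K y ×
  (∀ i → 0ℚ < x i → ∀ k → rowPay R y k - ε ≤ rowPay R y i) ×
  (∀ j → 0ℚ < y j → ∀ k → colPay C x k - ε ≤ colPay C x j)

uCoord : ∀ {K} → Subset K → Fin K → ℚ
uCoord S i = if mem S i then inv ∣ S ∣ else 0ℚ

EnumHard : (K : ℕ) → Mat K → Mat K → (ε τ c : ℚ) → (k : ℕ) → Subset K → Set
EnumHard K R' C' ε τ c k S =
  (c * ℕ→ℚ K ≡ ℕ→ℚ k) ×
  (∀ i j → (- 1ℚ ≤ R' i j × R' i j ≤ 1ℚ) × (- 1ℚ ≤ C' i j × C' i j ≤ 1ℚ)) ×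
  (∀ y → Simplex K y → ∃ λ i → + 1 / 2 ≤ rowPay R' y i) ×
  (∀ x → Simplex K x → ∃ λ j → + 1 / 2 ≤ colPay C' x j) ×
  (∀ x y → IsWNE R' C' ε x y →
     (∀ i → toℕ i ℕ.< k → x i ≢ 0ℚ → mem S i ≡ true) ×
     (∀ i → toℕ i ℕ.< k → y i ≢ 0ℚ → mem S i ≡ true) ×
     (Σ<ᶠ K k (λ i → abs (x i - c * uCoord S i)) ≤ τ * ε) ×
     (Σ<ᶠ K k (λ i → abs (y i - c * uCoord S i)) ≤ τ * ε))

{-# OPTIONS --safe #-}
module Submission where

open import Defs
open import Algebra.Bundles using (CommutativeRing)
open import Data.Bool using (Bool; true; false; if_then_else_; not; _∧_)
open import Data.Bool.Properties using (¬-not; T-≡)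
open import Data.Empty using (⊥)
open import Data.Fin using (Fin; zero; suc; toℕ; fromℕ<; splitAt; _↑ˡ_; _↑ʳ_)
open import Data.Fin.Properties using (splitAt-↑ˡ; splitAt-↑ʳ; splitAt-<; splitAt⁻¹-↑ˡ; toℕ-↑ˡ; toℕ-↑ʳ; toℕ<n)
open import Data.Fin.Subset using (Subset; _⊆_; _∈_; ∣_∣; inside; outside; _∩_; ∁)
open import Data.Fin.Subset.Properties
  using ( _∈?_; nonempty?; Empty-unique; ⊆-trans; drop-∷-⊆; s⊆s; out⊆; ⊥⊆; ∣⊥∣≡0; p⊆q⇒∣p∣≤∣q∣
        ; p∩q⊆p; p∩q⊆q; x∈p∩q⁺; x∉p⇒x∈∁p)
open import Data.Integer as ℤ using (+_; -[1+_])
import Data.Integer.Properties as ℤ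
open import Data.List using () renaming (_∷_ to _∷ₗ_; [] to []ₗ)
open import Data.Nat as ℕ using (ℕ; zero; suc; z≤n; s≤s)
open import Data.Nat.Combinatorics using (_C_)
import Data.Nat.Coprimality as C
import Data.Nat.Properties as ℕ
open import Data.Product using (∃; ∃₂; _×_; _,_; proj₁; proj₂; uncurry)
open import Data.Rational
  using (ℚ; mkℚ; 0ℚ; 1ℚ; ½; -½; _+_; _*_; _-_; -_; _≤_; _<_; _/_; _≤?_; _<?_; _≟_; nonNegative; positive)
  renaming (∣_∣ to abs)
open import Data.Rational.Properties
open import Data.Sum using (_⊎_; inj₁; inj₂) renaming (map to ⊎-map)
open import Data.Unit using (tt)
open import Data.Vec using ([]; _∷_; here; tabulate; _++_; replicate)
open import Data.Vec.Properties
  using (lookup⇒[]=; []=⇒lookup; lookup-zipWith; lookup-map; lookup∘tabulate; lookup-++ˡ)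
open import Function using (_∘_)
open import Function.Bundles using (Equivalence)
open import Level using (0ℓ)
open import Relation.Binary.PropositionalEquality
open import Relation.Nullary using (Dec; yes; no; does; ¬_; contradiction)
open import Relation.Nullary.Decidable using (True; toWitness; dec⇒maybe)
open import Tactic.RingSolver using (solve; solve-∀)
open import Tactic.RingSolver.Core.AlmostCommutativeRing using (AlmostCommutativeRing; fromCommutativeRing)
open import Algebra.Properties.CommutativeMonoid.Sum +-0-commutativeMonoid
  using (sum; sum-cong-≗; ∑-distrib-+; ∑-comm; sum-replicate-zero)
open import Algebra.Properties.Semiring.Sum (CommutativeRing.semiring +-*-commutativeRing)
  using (*-distribˡ-sum)

-- The affine rescaling turns ε-best responses of (R̃, C̃) into 6ε-best responses of the
-- block game (R, C) with swapped column halves, where every pure strategy earns 2 per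
-- unit of one half of the opponent's mass, -2 per unit of the other half, plus a
-- bilinear term of absolute value at most 1. Write x = (x₁, x₂) and y = (y₁, y₂) for the
-- halves indexed by the elements of [n] and by the m-subsets T b of S, and u for the
-- uniform distribution on S.
--
-- (1) A half is never played when the opponent's half rewarding it has mass below ⅓;
-- chasing this around shows that all four half-masses lie in [⅓, ⅔]. (2) Outside S the
-- bilinear part of an element is minus the opponent's subset mass, so x₁ and y₁ live on
-- S. (3) In the subgame of x₁ against y₂, the cross term Σ_b y₂(b) x₁(T b) is squeezed
-- between the two best-response conditions; pairing T b with its complement in S gives
-- ∣x₁(T b) - X₁/2∣ ≤ 18ε for every b, and splitting S by the sign of x₁ - X₁ u into
-- classes covered by two m-subsets gives ‖x₁ - X₁ u‖₁ ≤ 72ε; likewise for y₁ against x₂.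
-- (4) Comparing element with subset strategies balances the halves,
-- ∣X₁ - ½∣, ∣Y₁ - ½∣ ≤ 30ε, and 72ε + 30ε = 102ε.

ℚ-ring : AlmostCommutativeRing 0ℓ 0ℓ
ℚ-ring = fromCommutativeRing +-*-commutativeRing (λ p → dec⇒maybe (0ℚ ≟ p))

4ℚ 6ℚ ⅓ ⅔ : ℚ
4ℚ = + 4 / 1
6ℚ = + 6 / 1
⅓ = + 1 / 3
⅔ = + 2 / 3

decide-≤ : ∀ {p q} → True (p ≤? q) → p ≤ q
decide-≤ = toWitness

decide-< : ∀ {p q} → True (p <? q) → p < q
decide-< = toWitness

slack : ∀ {p q} → p ≤ q → 0ℚ ≤ q - p
slack {p} {q} p≤q = subst (_≤ q - p) (+-inverseʳ p) (+-monoˡ-≤ (- p) p≤q)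

+-nonNeg : ∀ {p q} → 0ℚ ≤ p → 0ℚ ≤ q → 0ℚ ≤ p + q
+-nonNeg = +-mono-≤

*-nonNeg : ∀ {p q} → 0ℚ ≤ p → 0ℚ ≤ q → 0ℚ ≤ p * q
*-nonNeg {p} 0≤p 0≤q = subst (_≤ p * _) (*-zeroʳ p) (*-monoˡ-≤-nonNeg p {{nonNegative 0≤p}} 0≤q)

scale : ∀ k {p} {_ : True (0ℚ ≤? k)} → 0ℚ ≤ p → 0ℚ ≤ k * p
scale k {_} {k≥0} = *-nonNeg (toWitness k≥0)

pos⊎zero : ∀ {p} → 0ℚ ≤ p → 0ℚ < p ⊎ p ≡ 0ℚ
pos⊎zero {p} 0≤p with 0ℚ <? p
... | yes 0<p = inj₁ 0<p
... | no 0≮p  = inj₂ (≤-antisym (≮⇒≥ 0≮p) 0≤p)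

nonNeg-not-pos : ∀ {p} → 0ℚ ≤ p → ¬ (0ℚ < p) → p ≤ 0ℚ
nonNeg-not-pos 0≤p 0≮p = ≤-reflexive (sym (≤-antisym 0≤p (≮⇒≥ 0≮p)))

neg-unique : ∀ {p q} → p + q ≡ 0ℚ → - q ≡ p
neg-unique {p} {q} p+q≡0 = begin
  - q             ≡⟨ +-identityˡ (- q) ⟨
  0ℚ - q          ≡⟨ cong (_- q) p+q≡0 ⟨
  p + q - q       ≡⟨ cancel p q ⟩
  p               ∎
  where
  open ≡-Reasoning
  cancel : ∀ p q → p + q - q ≡ p
  cancel = solve-∀ ℚ-ring

abs≤ : ∀ {p c} → - c ≤ p → p ≤ c → abs p ≤ c
abs≤ {p} {c} -c≤p p≤c with ∣p∣≡p∨∣p∣≡-p p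
... | inj₁ ∣p∣≡p  = subst (_≤ c) (sym ∣p∣≡p) p≤c
... | inj₂ ∣p∣≡-p = subst (_≤ c) (sym ∣p∣≡-p) (subst (- p ≤_) (neg-involutive c) (neg-antimono-≤ -c≤p))
  where
  neg-involutive : ∀ c → - (- c) ≡ c
  neg-involutive = solve-∀ ℚ-ring

≤abs : ∀ p → p ≤ abs p
≤abs p with 0ℚ ≤? p
... | yes 0≤p = ≤-reflexive (sym (0≤p⇒∣p∣≡p 0≤p))
... | no  0≰p = ≤-trans (<⇒≤ (≰⇒> 0≰p)) (0≤∣p∣ p)

-p≤∣p∣ : ∀ p → - p ≤ abs p
-p≤∣p∣ p = subst (- p ≤_) (∣-p∣≡∣p∣ p) (≤abs (- p))

ℕ→ℚ≡mkℚ : ∀ k → ℕ→ℚ k ≡ mkℚ (+ k) 0 (C.sym (C.1-coprimeTo k))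
ℕ→ℚ≡mkℚ k = ↥p/↧p≡p (mkℚ (+ k) 0 (C.sym (C.1-coprimeTo k)))

ℕ→ℚ-+ : ∀ a b → ℕ→ℚ (a ℕ.+ b) ≡ ℕ→ℚ a + ℕ→ℚ b
ℕ→ℚ-+ a b = begin
  + (a ℕ.+ b) / 1                     ≡⟨ /-cong numerators refl ⟩
  (+ a ℤ.* + 1 ℤ.+ + b ℤ.* + 1) / 1   ≡⟨ cong₂ _+_ (ℕ→ℚ≡mkℚ a) (ℕ→ℚ≡mkℚ b) ⟨
  ℕ→ℚ a + ℕ→ℚ b                       ∎
  where
  open ≡-Reasoning
  numerators : + (a ℕ.+ b) ≡ + a ℤ.* + 1 ℤ.+ + b ℤ.* + 1
  numerators = trans (ℤ.pos-+ a b) (sym (cong₂ ℤ._+_ (ℤ.*-identityʳ (+ a)) (ℤ.*-identityʳ (+ b))))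

-- A certificate writes q - p (resp. a negative constant c) as a nonnegative
-- combination z of hypotheses plus a vanishing term t; the ring solver checks it.
≤-by-certificate : ∀ {p q z t} → 0ℚ ≤ z → t ≡ 0ℚ → q - p ≡ z + t → p ≤ q
≤-by-certificate {p} {q} {z} 0≤z refl q-p≡z+0 =
  subst₂ _≤_ (+-identityˡ p) (q-p+p≡q q p) (+-monoˡ-≤ p 0≤q-p)
  where
  0≤q-p : 0ℚ ≤ q - p
  0≤q-p = subst (0ℚ ≤_) (trans (sym (+-identityʳ z)) (sym q-p≡z+0)) 0≤z
  q-p+p≡q : ∀ q p → q - p + p ≡ q
  q-p+p≡q = solve-∀ ℚ-ring

≤-by-scaled-certificate : ∀ {c p q z t} → 0ℚ < c → 0ℚ ≤ z → t ≡ 0ℚ → c * (q - p) ≡ z + t → p ≤ q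
≤-by-scaled-certificate {c} {p} {q} {z} 0<c 0≤z refl c[q-p]≡z+0 =
  ≤-by-certificate {t = 0ℚ} 0≤q-p refl (sym (+-identityʳ (q - p)))
  where
  0≤c[q-p] : 0ℚ ≤ c * (q - p)
  0≤c[q-p] = subst (0ℚ ≤_) (trans (sym (+-identityʳ z)) (sym c[q-p]≡z+0)) 0≤z
  0≤q-p : 0ℚ ≤ q - p
  0≤q-p = *-cancelˡ-≤-pos c {{positive 0<c}} (subst (_≤ c * (q - p)) (sym (*-zeroʳ c)) 0≤c[q-p])

⊥-by-certificate : ∀ {z t} c → 0ℚ ≤ z → t ≡ 0ℚ → z + t ≡ c → c < 0ℚ → ⊥
⊥-by-certificate {z} c 0≤z refl z+0≡c c<0 =
  <-irrefl refl (≤-<-trans (subst (0ℚ ≤_) (trans (sym (+-identityʳ z)) z+0≡c) 0≤z) c<0)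

vanishing : ∀ k {r} → r ≡ 1ℚ → k * (r - 1ℚ) ≡ 0ℚ
vanishing k r≡1 = trans (cong (λ r → k * (r - 1ℚ)) r≡1) (*-zeroʳ k)

Σᶠ≡sum : ∀ K (f : Fin K → ℚ) → Σᶠ K f ≡ sum f
Σᶠ≡sum zero    f = refl
Σᶠ≡sum (suc K) f = cong (_+_ (f zero)) (Σᶠ≡sum K (f ∘ suc))

Σᶠ-cong : ∀ K {f g : Fin K → ℚ} → (∀ i → f i ≡ g i) → Σᶠ K f ≡ Σᶠ K g
Σᶠ-cong K {f} {g} f≗g rewrite Σᶠ≡sum K f | Σᶠ≡sum K g = sum-cong-≗ f≗g

Σᶠ-+ : ∀ {K} (f g : Fin K → ℚ) → Σᶠ K (λ i → f i + g i) ≡ Σᶠ K f + Σᶠ K g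
Σᶠ-+ {K} f g rewrite Σᶠ≡sum K f | Σᶠ≡sum K g | Σᶠ≡sum K (λ i → f i + g i) = ∑-distrib-+ f g

Σᶠ-*ˡ : ∀ {K} c (f : Fin K → ℚ) → Σᶠ K (λ i → c * f i) ≡ c * Σᶠ K f
Σᶠ-*ˡ {K} c f rewrite Σᶠ≡sum K f | Σᶠ≡sum K (λ i → c * f i) = sym (*-distribˡ-sum c f)

Σᶠ-*ʳ : ∀ {K} (f : Fin K → ℚ) c → Σᶠ K (λ i → f i * c) ≡ Σᶠ K f * c
Σᶠ-*ʳ {K} f c = trans (Σᶠ-cong K (λ i → *-comm (f i) c)) (trans (Σᶠ-*ˡ c f) (*-comm c (Σᶠ K f)))

Σᶠ-zero : ∀ K → Σᶠ K (λ _ → 0ℚ) ≡ 0ℚ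
Σᶠ-zero K = trans (Σᶠ≡sum K _) (sum-replicate-zero K)

Σᶠ-comm : ∀ {K L} (f : Fin K → Fin L → ℚ) →
          Σᶠ K (λ i → Σᶠ L (f i)) ≡ Σᶠ L (λ j → Σᶠ K (λ i → f i j))
Σᶠ-comm {K} {L} f = begin
  Σᶠ K (λ i → Σᶠ L (f i))          ≡⟨ Σᶠ-cong K (λ i → Σᶠ≡sum L (f i)) ⟩
  Σᶠ K (λ i → sum (f i))           ≡⟨ Σᶠ≡sum K _ ⟩
  sum (λ i → sum (f i))            ≡⟨ ∑-comm f ⟩
  sum (λ j → sum (λ i → f i j))    ≡⟨ Σᶠ≡sum L _ ⟨
  Σᶠ L (λ j → sum (λ i → f i j))   ≡⟨ Σᶠ-cong L (λ j → Σᶠ≡sum K (λ i → f i j)) ⟨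
  Σᶠ L (λ j → Σᶠ K (λ i → f i j))  ∎
  where open ≡-Reasoning

Σᶠ-neg : ∀ K (f : Fin K → ℚ) → Σᶠ K (λ i → - f i) ≡ - Σᶠ K f
Σᶠ-neg zero    f = refl
Σᶠ-neg (suc K) f = trans (cong (_+_ (- f zero)) (Σᶠ-neg K (f ∘ suc))) (sym (neg-distrib-+ (f zero) (Σᶠ K (f ∘ suc))))

Σᶠ-- : ∀ {K} (f g : Fin K → ℚ) → Σᶠ K (λ i → f i - g i) ≡ Σᶠ K f - Σᶠ K g
Σᶠ-- {K} f g = trans (Σᶠ-+ f (λ i → - g i)) (cong (_+_ (Σᶠ K f)) (Σᶠ-neg K g))

Σᶠ-mono-≤ : ∀ K {f g : Fin K → ℚ} → (∀ i → f i ≤ g i) → Σᶠ K f ≤ Σᶠ K g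
Σᶠ-mono-≤ zero    f≤g = ≤-refl
Σᶠ-mono-≤ (suc K) f≤g = +-mono-≤ (f≤g zero) (Σᶠ-mono-≤ K (f≤g ∘ suc))

Σᶠ-nonNeg : ∀ K {f : Fin K → ℚ} → (∀ i → 0ℚ ≤ f i) → 0ℚ ≤ Σᶠ K f
Σᶠ-nonNeg K 0≤f = subst (_≤ Σᶠ K _) (Σᶠ-zero K) (Σᶠ-mono-≤ K 0≤f)

Σᶠ-nonPos : ∀ K {f : Fin K → ℚ} → (∀ i → f i ≤ 0ℚ) → Σᶠ K f ≤ 0ℚ
Σᶠ-nonPos K f≤0 = subst (Σᶠ K _ ≤_) (Σᶠ-zero K) (Σᶠ-mono-≤ K f≤0)

Σᶠ-↑ : ∀ m n (f : Fin (m ℕ.+ n) → ℚ) → Σᶠ (m ℕ.+ n) f ≡ Σᶠ m (f ∘ (_↑ˡ n)) + Σᶠ n (f ∘ (m ↑ʳ_))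
Σᶠ-↑ zero    n f = sym (+-identityˡ _)
Σᶠ-↑ (suc m) n f =
  trans (cong (_+_ (f zero)) (Σᶠ-↑ m n (f ∘ suc))) (sym (+-assoc (f zero) (Σᶠ m (f ∘ suc ∘ (_↑ˡ n))) _))

Σᶠ-shiftˡ : ∀ {K} c (g z : Fin K → ℚ) → Σᶠ K (λ i → (c + g i) * z i) ≡ c * Σᶠ K z + Σᶠ K (λ i → g i * z i)
Σᶠ-shiftˡ {K} c g z = begin
  Σᶠ K (λ i → (c + g i) * z i)                ≡⟨ Σᶠ-cong K (λ i → *-distribʳ-+ (z i) c (g i)) ⟩
  Σᶠ K (λ i → c * z i + g i * z i)            ≡⟨ Σᶠ-+ (λ i → c * z i) (λ i → g i * z i) ⟩
  Σᶠ K (λ i → c * z i) + Σᶠ K (λ i → g i * z i) ≡⟨ cong (_+ _) (Σᶠ-*ˡ c z) ⟩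
  c * Σᶠ K z + Σᶠ K (λ i → g i * z i)         ∎
  where open ≡-Reasoning

Σᶠ-shiftʳ : ∀ {K} c (g z : Fin K → ℚ) → Σᶠ K (λ i → z i * (c + g i)) ≡ c * Σᶠ K z + Σᶠ K (λ i → g i * z i)
Σᶠ-shiftʳ {K} c g z = trans (Σᶠ-cong K (λ i → *-comm (z i) (c + g i))) (Σᶠ-shiftˡ c g z)

Σᶠ-weighted-+ : ∀ {K} (w g : Fin K → ℚ) c →
                Σᶠ K (λ i → w i * (g i + c)) ≡ Σᶠ K (λ i → w i * g i) + Σᶠ K w * c
Σᶠ-weighted-+ {K} w g c = begin
  Σᶠ K (λ i → w i * (g i + c))                 ≡⟨ Σᶠ-cong K (λ i → *-distribˡ-+ (w i) (g i) c) ⟩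
  Σᶠ K (λ i → w i * g i + w i * c)             ≡⟨ Σᶠ-+ (λ i → w i * g i) (λ i → w i * c) ⟩
  Σᶠ K (λ i → w i * g i) + Σᶠ K (λ i → w i * c) ≡⟨ cong (_+_ (Σᶠ K (λ i → w i * g i))) (Σᶠ-*ʳ w c) ⟩
  Σᶠ K (λ i → w i * g i) + Σᶠ K w * c          ∎
  where open ≡-Reasoning

Σᶠ-weighted-- : ∀ {K} (w g : Fin K → ℚ) c →
                Σᶠ K (λ i → w i * (c - g i)) ≡ Σᶠ K w * c - Σᶠ K (λ i → w i * g i)
Σᶠ-weighted-- {K} w g c = begin
  Σᶠ K (λ i → w i * (c - g i))                 ≡⟨ Σᶠ-cong K (λ i → distrib (w i) c (g i)) ⟩
  Σᶠ K (λ i → w i * c - w i * g i)             ≡⟨ Σᶠ-- (λ i → w i * c) (λ i → w i * g i) ⟩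
  Σᶠ K (λ i → w i * c) - Σᶠ K (λ i → w i * g i) ≡⟨ cong (_- Σᶠ K (λ i → w i * g i)) (Σᶠ-*ʳ w c) ⟩
  Σᶠ K w * c - Σᶠ K (λ i → w i * g i)          ∎
  where
  open ≡-Reasoning
  distrib : ∀ w c g → w * (c - g) ≡ w * c - w * g
  distrib = solve-∀ ℚ-ring

Σᶠ-weighted-≤ : ∀ K (w g h : Fin K → ℚ) → (∀ i → 0ℚ ≤ w i) → (∀ i → 0ℚ < w i → g i ≤ h i) →
                Σᶠ K (λ i → w i * g i) ≤ Σᶠ K (λ i → w i * h i)
Σᶠ-weighted-≤ K w g h w≥0 g≤h = Σᶠ-mono-≤ K weighted
  where
  weighted : ∀ i → w i * g i ≤ w i * h i
  weighted i with pos⊎zero (w≥0 i)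
  ... | inj₁ w>0 = *-monoˡ-≤-nonNeg (w i) {{nonNegative (w≥0 i)}} (g≤h i w>0)
  ... | inj₂ w≡0 rewrite w≡0 = ≤-reflexive (trans (*-zeroˡ (g i)) (sym (*-zeroˡ (h i))))

Σᶠ-weighted-bound : ∀ {K} (w g : Fin K → ℚ) c d → (∀ i → 0ℚ ≤ w i) → (∀ i → 0ℚ < w i → c ≤ g i + d) →
                    Σᶠ K w * c ≤ Σᶠ K (λ i → w i * g i) + Σᶠ K w * d
Σᶠ-weighted-bound {K} w g c d w≥0 c≤g+d = begin
  Σᶠ K w * c                                   ≡⟨ Σᶠ-*ʳ w c ⟨
  Σᶠ K (λ i → w i * c)                         ≤⟨ Σᶠ-weighted-≤ K w (λ _ → c) (λ i → g i + d) w≥0 c≤g+d ⟩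
  Σᶠ K (λ i → w i * (g i + d))                 ≡⟨ Σᶠ-weighted-+ w g d ⟩
  Σᶠ K (λ i → w i * g i) + Σᶠ K w * d          ∎
  where open ≤-Reasoning

VanishesOutside : ∀ {n} → Subset n → (Fin n → ℚ) → Set
VanishesOutside S f = ∀ a → mem S a ≡ false → f a ≡ 0ℚ

restrict : ∀ {n} → Subset n → (Fin n → ℚ) → Fin n → ℚ
restrict U f a = if mem U a then f a else 0ℚ

Σ∈ : ∀ {n} → Subset n → (Fin n → ℚ) → ℚ
Σ∈ {n} U f = Σᶠ n (restrict U f)

Σ∈-const : ∀ {n} (U : Subset n) c → Σ∈ U (λ _ → c) ≡ ℕ→ℚ ∣ U ∣ * c
Σ∈-const []            c = sym (*-zeroˡ c)
Σ∈-const (outside ∷ U) c = trans (+-identityˡ _) (Σ∈-const U c)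
Σ∈-const (inside ∷ U)  c = begin
  c + Σ∈ U (λ _ → c)       ≡⟨ cong (_+_ c) (Σ∈-const U c) ⟩
  c + ℕ→ℚ ∣ U ∣ * c        ≡⟨ factor c (ℕ→ℚ ∣ U ∣) ⟩
  (1ℚ + ℕ→ℚ ∣ U ∣) * c     ≡⟨ cong (_* c) (ℕ→ℚ-+ 1 ∣ U ∣) ⟨
  ℕ→ℚ (suc ∣ U ∣) * c      ∎
  where
  open ≡-Reasoning
  factor : ∀ c k → c + k * c ≡ (1ℚ + k) * c
  factor = solve-∀ ℚ-ring

Σ∈-neg : ∀ {n} (U : Subset n) f → Σ∈ U (λ a → - f a) ≡ - Σ∈ U f
Σ∈-neg {n} U f = trans (Σᶠ-cong n pointwise) (Σᶠ-neg n _)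
  where
  pointwise : ∀ a → restrict U (λ b → - f b) a ≡ - restrict U f a
  pointwise a with mem U a
  ... | true  = refl
  ... | false = refl

Σ∈-affine : ∀ {n} (U : Subset n) f c g → Σ∈ U (λ a → f a - c * g a) ≡ Σ∈ U f - c * Σ∈ U g
Σ∈-affine {n} U f c g = begin
  Σ∈ U (λ a → f a - c * g a)                          ≡⟨ Σᶠ-cong n pointwise ⟩
  Σᶠ n (λ a → restrict U f a - c * restrict U g a)    ≡⟨ Σᶠ-- (restrict U f) (λ a → c * restrict U g a) ⟩
  Σ∈ U f - Σᶠ n (λ a → c * restrict U g a)            ≡⟨ cong (_-_ (Σ∈ U f)) (Σᶠ-*ˡ c (restrict U g)) ⟩
  Σ∈ U f - c * Σ∈ U g                                 ∎
  where
  open ≡-Reasoning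
  pointwise : ∀ a → restrict U (λ b → f b - c * g b) a ≡ restrict U f a - c * restrict U g a
  pointwise a with mem U a
  ... | true  = refl
  ... | false = sym (cong (_-_ 0ℚ) (*-zeroʳ c))

∈⇒mem : ∀ {n} {a : Fin n} {U} → a ∈ U → mem U a ≡ true
∈⇒mem = []=⇒lookup

mem⇒∈ : ∀ {n} {a : Fin n} {U} → mem U a ≡ true → a ∈ U
mem⇒∈ {a = a} {U} = lookup⇒[]= a U

⊆-mem : ∀ {n} {U W : Subset n} → U ⊆ W → ∀ {a} → mem U a ≡ true → mem W a ≡ true
⊆-mem U⊆W = ∈⇒mem ∘ U⊆W ∘ mem⇒∈

mem-∩ : ∀ {n} (p q : Subset n) a → mem (p ∩ q) a ≡ mem p a ∧ mem q a
mem-∩ p q a = lookup-zipWith _∧_ a p q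

mem-∁ : ∀ {n} (p : Subset n) a → mem (∁ p) a ≡ not (mem p a)
mem-∁ p a = lookup-map a not p

∣p∩q∣+∣p∩∁q∣≡∣p∣ : ∀ {n} (p q : Subset n) → ∣ p ∩ q ∣ ℕ.+ ∣ p ∩ ∁ q ∣ ≡ ∣ p ∣
∣p∩q∣+∣p∩∁q∣≡∣p∣ []            []            = refl
∣p∩q∣+∣p∩∁q∣≡∣p∣ (inside ∷ p)  (inside ∷ q)  = cong suc (∣p∩q∣+∣p∩∁q∣≡∣p∣ p q)
∣p∩q∣+∣p∩∁q∣≡∣p∣ (inside ∷ p)  (outside ∷ q) = trans (ℕ.+-suc _ _) (cong suc (∣p∩q∣+∣p∩∁q∣≡∣p∣ p q))
∣p∩q∣+∣p∩∁q∣≡∣p∣ (outside ∷ p) (_ ∷ q)       = ∣p∩q∣+∣p∩∁q∣≡∣p∣ p q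

∣p∩q∣≡∣q∣ : ∀ {n} {p q : Subset n} → q ⊆ p → ∣ p ∩ q ∣ ≡ ∣ q ∣
∣p∩q∣≡∣q∣ {p = p} {q} q⊆p =
  ℕ.≤-antisym (p⊆q⇒∣p∣≤∣q∣ (p∩q⊆q p q)) (p⊆q⇒∣p∣≤∣q∣ (λ a∈q → x∈p∩q⁺ (q⊆p a∈q , a∈q)))

∣p∩∁q∣+∣q∣≡∣p∣ : ∀ {n} {p q : Subset n} → q ⊆ p → ∣ p ∩ ∁ q ∣ ℕ.+ ∣ q ∣ ≡ ∣ p ∣
∣p∩∁q∣+∣q∣≡∣p∣ {p = p} {q} q⊆p =
  trans (ℕ.+-comm _ ∣ q ∣) (trans (cong (ℕ._+ ∣ p ∩ ∁ q ∣) (sym (∣p∩q∣≡∣q∣ q⊆p))) (∣p∩q∣+∣p∩∁q∣≡∣p∣ p q))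

⊆-extend : ∀ {n} {V W : Subset n} k → V ⊆ W → ∣ V ∣ ℕ.≤ k → k ℕ.≤ ∣ W ∣ →
           ∃ λ U → V ⊆ U × U ⊆ W × ∣ U ∣ ≡ k
⊆-extend {V = []} {[]} zero _ _ _ = [] , (λ ()) , (λ ()) , refl
⊆-extend {V = inside ∷ V} {outside ∷ W} k V⊆W _ _ = contradiction (V⊆W here) λ ()
⊆-extend {V = inside ∷ V} {inside ∷ W} (suc k) V⊆W (s≤s ∣V∣≤k) (s≤s k≤∣W∣)
  with U , V⊆U , U⊆W , ∣U∣≡k ← ⊆-extend k (drop-∷-⊆ V⊆W) ∣V∣≤k k≤∣W∣
  = inside ∷ U , s⊆s V⊆U , s⊆s U⊆W , cong suc ∣U∣≡k
⊆-extend {V = outside ∷ V} {outside ∷ W} k V⊆W ∣V∣≤k k≤∣W∣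
  with U , V⊆U , U⊆W , ∣U∣≡k ← ⊆-extend k (drop-∷-⊆ V⊆W) ∣V∣≤k k≤∣W∣
  = outside ∷ U , s⊆s V⊆U , s⊆s U⊆W , ∣U∣≡k
⊆-extend {V = outside ∷ V} {inside ∷ W} k V⊆W ∣V∣≤k k≤∣W∣ with k ℕ.≤? ∣ W ∣
... | yes k≤∣W∣′ with U , V⊆U , U⊆W , ∣U∣≡k ← ⊆-extend k (drop-∷-⊆ V⊆W) ∣V∣≤k k≤∣W∣′
  = outside ∷ U , s⊆s V⊆U , out⊆ U⊆W , ∣U∣≡k
⊆-extend {V = outside ∷ V} {inside ∷ W} zero _ _ _ | no 0≰∣W∣ = contradiction z≤n 0≰∣W∣
⊆-extend {V = outside ∷ V} {inside ∷ W} (suc k) V⊆W _ (s≤s k≤∣W∣) | no k≰∣W∣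
  with U , V⊆U , U⊆W , ∣U∣≡k
         ← ⊆-extend k (drop-∷-⊆ V⊆W) (ℕ.≤-trans (p⊆q⇒∣p∣≤∣q∣ (drop-∷-⊆ V⊆W)) (ℕ.≤-pred (ℕ.≰⇒> k≰∣W∣))) k≤∣W∣
  = inside ∷ U , out⊆ V⊆U , s⊆s U⊆W , cong suc ∣U∣≡k

∣W∩∁U∣≤m : ∀ {n} m {S W U : Subset n} → ∣ S ∣ ≡ m ℕ.+ m → W ⊆ S → U ⊆ W → ∣ U ∣ ≡ m →
           ∣ W ∩ ∁ U ∣ ℕ.≤ m
∣W∩∁U∣≤m m {S} {W} {U} ∣S∣≡2m W⊆S U⊆W ∣U∣≡m = ℕ.+-cancelʳ-≤ m _ _ (begin
  ∣ W ∩ ∁ U ∣ ℕ.+ m      ≡⟨ cong (∣ W ∩ ∁ U ∣ ℕ.+_) ∣U∣≡m ⟨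
  ∣ W ∩ ∁ U ∣ ℕ.+ ∣ U ∣  ≡⟨ ∣p∩∁q∣+∣q∣≡∣p∣ U⊆W ⟩
  ∣ W ∣                 ≤⟨ subst (∣ W ∣ ℕ.≤_) ∣S∣≡2m (p⊆q⇒∣p∣≤∣q∣ W⊆S) ⟩
  m ℕ.+ m               ∎)
  where open ℕ.≤-Reasoning

halves-cover : ∀ {n} m {S W : Subset n} → ∣ S ∣ ≡ m ℕ.+ m → W ⊆ S → m ℕ.≤ ∣ W ∣ →
               ∃₂ λ U₁ U₂ → (U₁ ⊆ W × ∣ U₁ ∣ ≡ m) × (U₂ ⊆ W × ∣ U₂ ∣ ≡ m) ×
                            (∀ {a} → a ∈ W → a ∈ U₁ ⊎ a ∈ U₂)
halves-cover {n} m {S} {W} ∣S∣≡2m W⊆S m≤∣W∣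
  with U₁ , _ , U₁⊆W , ∣U₁∣≡m ← ⊆-extend m (⊥⊆ {p = W}) (subst (ℕ._≤ m) (sym (∣⊥∣≡0 n)) z≤n) m≤∣W∣
  with U₂ , rest⊆U₂ , U₂⊆W , ∣U₂∣≡m ← ⊆-extend m (p∩q⊆p W (∁ U₁)) (∣W∩∁U∣≤m m ∣S∣≡2m W⊆S U₁⊆W ∣U₁∣≡m) m≤∣W∣
  = U₁ , U₂ , (U₁⊆W , ∣U₁∣≡m) , (U₂⊆W , ∣U₂∣≡m) , covered
  where
  covered : ∀ {a} → a ∈ W → a ∈ U₁ ⊎ a ∈ U₂
  covered {a} a∈W with a ∈? U₁
  ... | yes a∈U₁ = inj₁ a∈U₁
  ... | no  a∉U₁ = inj₂ (rest⊆U₂ (x∈p∩q⁺ (a∈W , x∉p⇒x∈∁p a∉U₁)))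

if-≤-cover : ∀ (w u₁ u₂ : Bool) {x} → (u₁ ≡ true → w ≡ true) → (u₂ ≡ true → w ≡ true) →
             (w ≡ true → u₁ ≡ true ⊎ u₂ ≡ true) → (w ≡ true → 0ℚ ≤ x) →
             (if w then x else 0ℚ) ≤ (if u₁ then x else 0ℚ) + (if u₂ then x else 0ℚ)
if-≤-cover true  true  true  {x} _ _ _ x≥0 = subst (_≤ x + x) (+-identityʳ x) (+-monoʳ-≤ x (x≥0 refl))
if-≤-cover true  true  false {x} _ _ _ _   = ≤-reflexive (sym (+-identityʳ x))
if-≤-cover true  false true  {x} _ _ _ _   = ≤-reflexive (sym (+-identityˡ x))
if-≤-cover true  false false _ _ cover _ with cover refl
... | inj₁ ()
... | inj₂ ()
if-≤-cover false true  _     u₁⇒w _ _ _ with u₁⇒w refl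
... | ()
if-≤-cover false false true  _ u₂⇒w _ _ with u₂⇒w refl
... | ()
if-≤-cover false false false _ _ _ _ = ≤-refl

Σ∈-≤-cover : ∀ {n} {W U₁ U₂ : Subset n} (g : Fin n → ℚ) → U₁ ⊆ W → U₂ ⊆ W →
             (∀ {a} → a ∈ W → a ∈ U₁ ⊎ a ∈ U₂) → (∀ a → mem W a ≡ true → 0ℚ ≤ g a) →
             Σ∈ W g ≤ Σ∈ U₁ g + Σ∈ U₂ g
Σ∈-≤-cover {n} {W} {U₁} {U₂} g U₁⊆W U₂⊆W covered g≥0 =
  ≤-trans (Σᶠ-mono-≤ n pointwise) (≤-reflexive (Σᶠ-+ (restrict U₁ g) (restrict U₂ g)))
  where
  pointwise : ∀ a → restrict W g a ≤ restrict U₁ g a + restrict U₂ g a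
  pointwise a = if-≤-cover (mem W a) (mem U₁ a) (mem U₂ a) (⊆-mem U₁⊆W) (⊆-mem U₂⊆W)
                  (⊎-map ∈⇒mem ∈⇒mem ∘ covered ∘ mem⇒∈) (g≥0 a)

Σ∈-≤-two-halves : ∀ {n} m {S W : Subset n} → ∣ S ∣ ≡ m ℕ.+ m → W ⊆ S → m ℕ.≤ ∣ W ∣ →
                  (g : Fin n → ℚ) → (∀ a → mem W a ≡ true → 0ℚ ≤ g a) → ∀ δ →
                  (∀ U → U ⊆ S → ∣ U ∣ ≡ m → Σ∈ U g ≤ δ) → Σ∈ W g ≤ δ + δ
Σ∈-≤-two-halves m ∣S∣≡2m W⊆S m≤∣W∣ g g≥0 δ half≤δ
  with U₁ , U₂ , (U₁⊆W , ∣U₁∣≡m) , (U₂⊆W , ∣U₂∣≡m) , covered ← halves-cover m ∣S∣≡2m W⊆S m≤∣W∣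
  = ≤-trans (Σ∈-≤-cover g U₁⊆W U₂⊆W covered g≥0)
            (+-mono-≤ (half≤δ U₁ (⊆-trans U₁⊆W W⊆S) ∣U₁∣≡m) (half≤δ U₂ (⊆-trans U₂⊆W W⊆S) ∣U₂∣≡m))

abs-by-sign : ∀ (s : Bool) x (d : Dec (0ℚ ≤ x)) → (s ≡ false → x ≡ 0ℚ) →
              abs x ≡ (if s ∧ does d then x else 0ℚ) + (if s ∧ not (does d) then - x else 0ℚ)
abs-by-sign false x d x≡0 rewrite x≡0 refl with does d
... | true  = refl
... | false = refl
abs-by-sign true x (yes 0≤x) _ = trans (0≤p⇒∣p∣≡p 0≤x) (sym (+-identityʳ x))
abs-by-sign true x (no 0≰x)  _ = trans (sym (∣-p∣≡∣p∣ x)) (trans (0≤p⇒∣p∣≡p 0≤-x) (sym (+-identityˡ (- x))))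
  where 0≤-x = neg-antimono-≤ (<⇒≤ (≰⇒> 0≰x))

split-by-sign : ∀ (s : Bool) x (d : Dec (0ℚ ≤ x)) → (s ≡ false → x ≡ 0ℚ) →
                x ≡ (if s ∧ does d then x else 0ℚ) + (if s ∧ not (does d) then x else 0ℚ)
split-by-sign false x d x≡0 rewrite x≡0 refl with does d
... | true  = refl
... | false = refl
split-by-sign true x (yes _) _ = sym (+-identityʳ x)
split-by-sign true x (no _)  _ = sym (+-identityˡ x)

∧-does : ∀ {A : Set} s (d : Dec A) → s ∧ does d ≡ true → A
∧-does true (yes a) _ = a

∧-not-does : ∀ {A : Set} s (d : Dec A) → s ∧ not (does d) ≡ true → ¬ A
∧-not-does true (no ¬a) _ = ¬a

module SignSplit {n} (S : Subset n) (f : Fin n → ℚ) (f-outside : VanishesOutside S f) where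

  nonNeg? : Subset n
  nonNeg? = tabulate (λ a → does (0ℚ ≤? f a))

  P N : Subset n
  P = S ∩ nonNeg?
  N = S ∩ ∁ nonNeg?

  -f : Fin n → ℚ
  -f a = - f a

  mem-P : ∀ a → mem P a ≡ mem S a ∧ does (0ℚ ≤? f a)
  mem-P a = trans (mem-∩ S nonNeg? a) (cong (mem S a ∧_) (lookup∘tabulate _ a))

  mem-N : ∀ a → mem N a ≡ mem S a ∧ not (does (0ℚ ≤? f a))
  mem-N a = trans (mem-∩ S (∁ nonNeg?) a) (cong (mem S a ∧_) (trans (mem-∁ nonNeg? a) (cong not (lookup∘tabulate _ a))))

  ∣P∣+∣N∣≡∣S∣ : ∣ P ∣ ℕ.+ ∣ N ∣ ≡ ∣ S ∣
  ∣P∣+∣N∣≡∣S∣ = ∣p∩q∣+∣p∩∁q∣≡∣p∣ S nonNeg?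

  Σ∣f∣≡ΣP+ΣN : Σᶠ n (λ a → abs (f a)) ≡ Σ∈ P f + Σ∈ N -f
  Σ∣f∣≡ΣP+ΣN = trans (Σᶠ-cong n pointwise) (Σᶠ-+ (restrict P f) (restrict N -f))
    where
    pointwise : ∀ a → abs (f a) ≡ restrict P f a + restrict N -f a
    pointwise a rewrite mem-P a | mem-N a = abs-by-sign (mem S a) (f a) (0ℚ ≤? f a) (f-outside a)

  ΣN≡ΣP : Σᶠ n f ≡ 0ℚ → Σ∈ N -f ≡ Σ∈ P f
  ΣN≡ΣP Σf≡0 = trans (Σ∈-neg N f) (neg-unique ΣP+ΣN≡0)
    where
    pointwise : ∀ a → f a ≡ restrict P f a + restrict N f a
    pointwise a rewrite mem-P a | mem-N a = split-by-sign (mem S a) (f a) (0ℚ ≤? f a) (f-outside a)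
    ΣP+ΣN≡0 : Σ∈ P f + Σ∈ N f ≡ 0ℚ
    ΣP+ΣN≡0 = trans (sym (Σᶠ-+ (restrict P f) (restrict N f))) (trans (sym (Σᶠ-cong n pointwise)) Σf≡0)

  P-nonNeg : ∀ a → mem P a ≡ true → 0ℚ ≤ f a
  P-nonNeg a a∈P = ∧-does (mem S a) (0ℚ ≤? f a) (trans (sym (mem-P a)) a∈P)

  N-nonNeg : ∀ a → mem N a ≡ true → 0ℚ ≤ -f a
  N-nonNeg a a∈N = neg-antimono-≤ (<⇒≤ (≰⇒> (∧-not-does (mem S a) (0ℚ ≤? f a) (trans (sym (mem-N a)) a∈N))))

-- On the larger of the two sign classes f has constant sign, and since Σ f = 0
-- both classes contribute equally to Σ ∣f∣.
Σ∣f∣≤4δ : ∀ {n} m (S : Subset n) → ∣ S ∣ ≡ m ℕ.+ m → (f : Fin n → ℚ) →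
          VanishesOutside S f → Σᶠ n f ≡ 0ℚ → ∀ δ →
          (∀ U → U ⊆ S → ∣ U ∣ ≡ m → abs (Σ∈ U f) ≤ δ) →
          Σᶠ n (λ a → abs (f a)) ≤ (δ + δ) + (δ + δ)
Σ∣f∣≤4δ {n} m S ∣S∣≡2m f f-outside Σf≡0 δ half-bound = by-larger-class (m ℕ.≤? ∣ P ∣)
  where
  open SignSplit S f f-outside
  f-bound : ∀ U → U ⊆ S → ∣ U ∣ ≡ m → Σ∈ U f ≤ δ
  f-bound U U⊆S ∣U∣≡m = ≤-trans (≤abs _) (half-bound U U⊆S ∣U∣≡m)
  -f-bound : ∀ U → U ⊆ S → ∣ U ∣ ≡ m → Σ∈ U -f ≤ δ
  -f-bound U U⊆S ∣U∣≡m = subst (_≤ δ) (sym (Σ∈-neg U f)) (≤-trans (-p≤∣p∣ _) (half-bound U U⊆S ∣U∣≡m))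
  by-larger-class : Dec (m ℕ.≤ ∣ P ∣) → Σᶠ n (λ a → abs (f a)) ≤ (δ + δ) + (δ + δ)
  by-larger-class (yes m≤∣P∣) = begin
    Σᶠ n (λ a → abs (f a))   ≡⟨ Σ∣f∣≡ΣP+ΣN ⟩
    Σ∈ P f + Σ∈ N -f         ≡⟨ cong (_+_ (Σ∈ P f)) (ΣN≡ΣP Σf≡0) ⟩
    Σ∈ P f + Σ∈ P f          ≤⟨ +-mono-≤ ΣP≤2δ ΣP≤2δ ⟩
    (δ + δ) + (δ + δ)        ∎
    where
    open ≤-Reasoning
    ΣP≤2δ = Σ∈-≤-two-halves m ∣S∣≡2m (p∩q⊆p S _) m≤∣P∣ f P-nonNeg δ f-bound
  by-larger-class (no m≰∣P∣) = begin
    Σᶠ n (λ a → abs (f a))   ≡⟨ Σ∣f∣≡ΣP+ΣN ⟩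
    Σ∈ P f + Σ∈ N -f         ≡⟨ cong (_+ Σ∈ N -f) (ΣN≡ΣP Σf≡0) ⟨
    Σ∈ N -f + Σ∈ N -f        ≤⟨ +-mono-≤ ΣN≤2δ ΣN≤2δ ⟩
    (δ + δ) + (δ + δ)        ∎
    where
    open ≤-Reasoning
    m≤∣N∣ : m ℕ.≤ ∣ N ∣
    m≤∣N∣ = ℕ.+-cancelˡ-≤ ∣ P ∣ _ _ (subst (ℕ._≤_ (∣ P ∣ ℕ.+ m)) (sym (trans ∣P∣+∣N∣≡∣S∣ ∣S∣≡2m))
              (ℕ.+-monoˡ-≤ m (ℕ.<⇒≤ (ℕ.≰⇒> m≰∣P∣))))
    ΣN≤2δ = Σ∈-≤-two-halves m ∣S∣≡2m (p∩q⊆p S _) m≤∣N∣ -f N-nonNeg δ -f-bound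

-- Payoff of a pure strategy of the block game: the opponent has mass p on the half
-- that pays 2 and q on the half that pays -2, and v is the bilinear part.
gain : ℚ → ℚ → ℚ → ℚ
gain p q v = 2ℚ * p - 2ℚ * q + v

unscale : ∀ {p q ε} → (p + 3ℚ) * (+ 1 / 6) - ε ≤ (q + 3ℚ) * (+ 1 / 6) → p - 6ℚ * ε ≤ q
unscale {p} {q} {ε} h = ≤-by-certificate (scale 6ℚ (slack h)) refl (solve (p ∷ₗ q ∷ₗ ε ∷ₗ []ₗ) ℚ-ring)

gain-cancel : ∀ {p q v w η} → (2ℚ * p - 2ℚ * q + v) - η ≤ 2ℚ * p - 2ℚ * q + w → v ≤ w + η
gain-cancel {p} {q} {v} {w} {η} h = ≤-by-certificate (slack h) refl (solve (p ∷ₗ q ∷ₗ v ∷ₗ w ∷ₗ η ∷ₗ []ₗ) ℚ-ring)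

gain-swap : ∀ {p q v w η} → (2ℚ * p - 2ℚ * q + v) - η ≤ 2ℚ * q - 2ℚ * p + w → v ≤ w + (4ℚ * q - 4ℚ * p + η)
gain-swap {p} {q} {v} {w} {η} h = ≤-by-certificate (slack h) refl (solve (p ∷ₗ q ∷ₗ v ∷ₗ w ∷ₗ η ∷ₗ []ₗ) ℚ-ring)

light-side-loses : ∀ {p q v w ε} → p + q ≡ 1ℚ → (2ℚ * q - 2ℚ * p + w) - 6ℚ * ε ≤ 2ℚ * p - 2ℚ * q + v →
                   v ≤ 1ℚ → 0ℚ ≤ w → p < ⅓ → ε < + 1 / 26 → ⊥
light-side-loses {p} {q} {v} {w} {ε} p+q≡1 h v≤1 0≤w p<⅓ ε<1/26 =
  ⊥-by-certificate (-[1+ 3 ] / 39)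
    (+-nonNeg (+-nonNeg (+-nonNeg (slack h) (slack v≤1)) (+-nonNeg 0≤w (scale (+ 8 / 1) (slack (<⇒≤ p<⅓)))))
              (scale 6ℚ (slack (<⇒≤ ε<1/26))))
    (vanishing 4ℚ p+q≡1)
    (solve (p ∷ₗ q ∷ₗ v ∷ₗ w ∷ₗ ε ∷ₗ []ₗ) ℚ-ring)
    (decide-< tt)

support-loses : ∀ {s ε} → ½ * s ≤ - s + 6ℚ * ε → ⅓ ≤ s → ε < + 1 / 26 → ⊥
support-loses {s} {ε} h ⅓≤s ε<1/26 =
  ⊥-by-certificate (-[1+ 6 ] / 26)
    (+-nonNeg (+-nonNeg (slack h) (scale (+ 3 / 2) (slack ⅓≤s))) (scale 6ℚ (slack (<⇒≤ ε<1/26))))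
    refl (solve (s ∷ₗ ε ∷ₗ []ₗ) ℚ-ring) (decide-< tt)

mass-split-⊥ : ∀ {p q} → p + q ≡ 1ℚ → p ≤ 0ℚ → q < ⅓ → ⊥
mass-split-⊥ {p} {q} p+q≡1 p≤0 q<⅓ =
  ⊥-by-certificate (-[1+ 1 ] / 3) (+-nonNeg (slack p≤0) (slack (<⇒≤ q<⅓))) (vanishing 1ℚ p+q≡1)
    (solve (p ∷ₗ q ∷ₗ []ₗ) ℚ-ring) (decide-< tt)

mass≤⅔ : ∀ {p q} → p + q ≡ 1ℚ → ⅓ ≤ q → p ≤ ⅔
mass≤⅔ {p} {q} p+q≡1 ⅓≤q = ≤-by-certificate (slack ⅓≤q) (vanishing (- 1ℚ) p+q≡1) (solve (p ∷ₗ q ∷ₗ []ₗ) ℚ-ring)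

mass≤1 : ∀ {p q} → p + q ≡ 1ℚ → 0ℚ ≤ q → p ≤ 1ℚ
mass≤1 {p} {q} p+q≡1 0≤q = ≤-by-certificate (slack 0≤q) (vanishing (- 1ℚ) p+q≡1) (solve (p ∷ₗ q ∷ₗ []ₗ) ℚ-ring)

complement-slack : ∀ {X t t′ η} → X - t′ ≤ (X - t) + η → t ≤ t′ + η
complement-slack {X} {t} {t′} {η} h = ≤-by-certificate (slack h) refl (solve (X ∷ₗ t ∷ₗ t′ ∷ₗ η ∷ₗ []ₗ) ℚ-ring)

half≤complement : ∀ {X t} → t ≤ ½ * X → ½ * X ≤ X - t
half≤complement {X} {t} h = ≤-by-certificate (slack h) refl (solve (X ∷ₗ t ∷ₗ []ₗ) ℚ-ring)

complement-light : ∀ {t t′ E} → t + t′ ≡ E → ½ * E ≤ t → t′ ≤ ½ * E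
complement-light {t} {t′} {E} t+t′≡E h =
  ≤-by-certificate (slack h) (trans (cong (_-_ E) t+t′≡E) (+-inverseʳ E)) (solve (t ∷ₗ t′ ∷ₗ E ∷ₗ []ₗ) ℚ-ring)

subset-mass-lower : ∀ {t E Sm W η} → W ≤ Sm * (t + η) → E * (½ * Sm) ≤ W + E * η →
                    0ℚ ≤ η → ⅓ ≤ Sm → E ≤ ⅔ → ½ * E - 3ℚ * η ≤ t
subset-mass-lower {t} {E} {Sm} {W} {η} W≤ ≤W 0≤η ⅓≤Sm E≤⅔ =
  ≤-by-scaled-certificate (<-≤-trans (decide-< tt) ⅓≤Sm)
    (+-nonNeg (+-nonNeg (slack W≤) (slack ≤W)) (*-nonNeg 0≤η (+-nonNeg (scale 2ℚ (slack ⅓≤Sm)) (slack E≤⅔))))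
    refl (solve (t ∷ₗ E ∷ₗ Sm ∷ₗ W ∷ₗ η ∷ₗ []ₗ) ℚ-ring)

subset-mass-upper : ∀ {t t′ E η} → t + t′ ≡ E → ½ * E - 3ℚ * η ≤ t′ → t ≤ ½ * E + 3ℚ * η
subset-mass-upper {t} {t′} {E} {η} t+t′≡E h =
  ≤-by-certificate (slack h) (trans (cong (_-_ E) t+t′≡E) (+-inverseʳ E)) (solve (t ∷ₗ t′ ∷ₗ E ∷ₗ η ∷ₗ []ₗ) ℚ-ring)

∣t-½E∣≤δ : ∀ {t E δ} → ½ * E - δ ≤ t → t ≤ ½ * E + δ → abs (t - E * ½) ≤ δ
∣t-½E∣≤δ {t} {E} {δ} lower upper =
  abs≤ (≤-by-certificate (slack lower) refl (solve (t ∷ₗ E ∷ₗ δ ∷ₗ []ₗ) ℚ-ring))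
       (≤-by-certificate (slack upper) refl (solve (t ∷ₗ E ∷ₗ δ ∷ₗ []ₗ) ℚ-ring))

-- In each balance bound, eliminating W and the complementary mass bounds c Z times the
-- deviation from ½ by 6ε (Z + M), where c ∈ {7, 9}, Z ≥ ⅓ and M ≤ ⅔ are the masses in
-- the last hypotheses; so the deviation is at most 18ε / c, and 30ε is generous.
balance-upper₁ : ∀ {X₁ X₂ Y W ε} → X₁ + X₂ ≡ 1ℚ →
                 Y * (½ * X₂) ≤ (Y * X₁ - W) + Y * (4ℚ * X₂ - 4ℚ * X₁ + 6ℚ * ε) →
                 X₁ * (½ * Y) ≤ W + X₁ * (6ℚ * ε) →
                 ⅓ ≤ Y → X₁ ≤ ⅔ → 0ℚ ≤ ε → X₁ - ½ ≤ + 30 / 1 * ε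
balance-upper₁ {X₁} {X₂} {Y} {W} {ε} X₁+X₂≡1 h₁ h₂ ⅓≤Y X₁≤⅔ 0≤ε =
  ≤-by-scaled-certificate (<-≤-trans (decide-< tt) ⅓≤Y)
    (scale (+ 1 / 7) (+-nonNeg (+-nonNeg (slack h₁) (slack h₂))
      (*-nonNeg (scale 6ℚ 0≤ε) (+-nonNeg (+-nonNeg (scale (+ 34 / 1) (slack ⅓≤Y)) (slack X₁≤⅔)) (decide-≤ {0ℚ} {+ 32 / 3} tt)))))
    (vanishing (Y * -½) X₁+X₂≡1) (solve (X₁ ∷ₗ X₂ ∷ₗ Y ∷ₗ W ∷ₗ ε ∷ₗ []ₗ) ℚ-ring)

balance-lower₁ : ∀ {X₁ X₂ Y W ε} → X₁ + X₂ ≡ 1ℚ →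
                 Y * (½ * X₁) ≤ W + Y * (4ℚ * X₁ - 4ℚ * X₂ + 6ℚ * ε) →
                 W ≤ X₂ * (½ * Y + 6ℚ * ε) →
                 ⅓ ≤ Y → X₂ ≤ ⅔ → 0ℚ ≤ ε → - (+ 30 / 1 * ε) ≤ X₁ - ½
balance-lower₁ {X₁} {X₂} {Y} {W} {ε} X₁+X₂≡1 h₁ h₂ ⅓≤Y X₂≤⅔ 0≤ε =
  ≤-by-scaled-certificate (<-≤-trans (decide-< tt) ⅓≤Y)
    (scale (+ 1 / 7) (+-nonNeg (+-nonNeg (slack h₁) (slack h₂))
      (*-nonNeg (scale 6ℚ 0≤ε) (+-nonNeg (+-nonNeg (scale (+ 34 / 1) (slack ⅓≤Y)) (slack X₂≤⅔)) (decide-≤ {0ℚ} {+ 32 / 3} tt)))))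
    (vanishing (Y * ½) X₁+X₂≡1) (solve (X₁ ∷ₗ X₂ ∷ₗ Y ∷ₗ W ∷ₗ ε ∷ₗ []ₗ) ℚ-ring)

balance-upper₂ : ∀ {Y₁ Y₂ X W ε} → Y₁ + Y₂ ≡ 1ℚ →
                 X * (½ * Y₁) ≤ W + X * (4ℚ * Y₂ - 4ℚ * Y₁ + 6ℚ * ε) →
                 W ≤ Y₂ * (½ * X + 6ℚ * ε) →
                 ⅓ ≤ X → Y₂ ≤ ⅔ → 0ℚ ≤ ε → Y₁ - ½ ≤ + 30 / 1 * ε
balance-upper₂ {Y₁} {Y₂} {X} {W} {ε} Y₁+Y₂≡1 h₁ h₂ ⅓≤X Y₂≤⅔ 0≤ε =
  ≤-by-scaled-certificate (<-≤-trans (decide-< tt) ⅓≤X)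
    (scale (+ 1 / 9) (+-nonNeg (+-nonNeg (slack h₁) (slack h₂))
      (*-nonNeg (scale 6ℚ 0≤ε) (+-nonNeg (+-nonNeg (scale (+ 44 / 1) (slack ⅓≤X)) (slack Y₂≤⅔)) (decide-≤ {0ℚ} {+ 14 / 1} tt)))))
    (vanishing (X * -½) Y₁+Y₂≡1) (solve (Y₁ ∷ₗ Y₂ ∷ₗ X ∷ₗ W ∷ₗ ε ∷ₗ []ₗ) ℚ-ring)

balance-lower₂ : ∀ {Y₁ Y₂ X W ε} → Y₁ + Y₂ ≡ 1ℚ →
                 X * (½ * Y₂) ≤ (X * Y₁ - W) + X * (4ℚ * Y₁ - 4ℚ * Y₂ + 6ℚ * ε) →
                 Y₁ * (½ * X) ≤ W + Y₁ * (6ℚ * ε) →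
                 ⅓ ≤ X → Y₁ ≤ ⅔ → 0ℚ ≤ ε → - (+ 30 / 1 * ε) ≤ Y₁ - ½
balance-lower₂ {Y₁} {Y₂} {X} {W} {ε} Y₁+Y₂≡1 h₁ h₂ ⅓≤X Y₁≤⅔ 0≤ε =
  ≤-by-scaled-certificate (<-≤-trans (decide-< tt) ⅓≤X)
    (scale (+ 1 / 9) (+-nonNeg (+-nonNeg (slack h₁) (slack h₂))
      (*-nonNeg (scale 6ℚ 0≤ε) (+-nonNeg (+-nonNeg (scale (+ 44 / 1) (slack ⅓≤X)) (slack Y₁≤⅔)) (decide-≤ {0ℚ} {+ 14 / 1} tt)))))
    (vanishing (X * ½) Y₁+Y₂≡1) (solve (Y₁ ∷ₗ Y₂ ∷ₗ X ∷ₗ W ∷ₗ ε ∷ₗ []ₗ) ℚ-ring)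

rescaled-entry-bounds : ∀ {r} → - 3ℚ ≤ r → r ≤ 3ℚ → - 1ℚ ≤ (r + 3ℚ) * (+ 1 / 6) × (r + 3ℚ) * (+ 1 / 6) ≤ 1ℚ
rescaled-entry-bounds {r} -3≤r r≤3 =
  ≤-by-certificate (+-nonNeg (decide-≤ {0ℚ} {1ℚ} tt) (scale (+ 1 / 6) (slack -3≤r))) refl (solve (r ∷ₗ []ₗ) ℚ-ring) ,
  ≤-by-certificate (scale (+ 1 / 6) (slack r≤3)) refl (solve (r ∷ₗ []ₗ) ℚ-ring)

½≤rescaled-gain : ∀ {p q v} → q ≤ p → 0ℚ ≤ v → ½ ≤ ((2ℚ * p - 2ℚ * q + v) + 3ℚ) * (+ 1 / 6)
½≤rescaled-gain {p} {q} {v} q≤p 0≤v =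
  ≤-by-certificate (+-nonNeg (scale ⅓ (slack q≤p)) (scale (+ 1 / 6) 0≤v)) refl (solve (p ∷ₗ q ∷ₗ v ∷ₗ []ₗ) ℚ-ring)

12η+30ε≡102ε : ∀ ε → ((3ℚ * (6ℚ * ε) + 3ℚ * (6ℚ * ε)) + (3ℚ * (6ℚ * ε) + 3ℚ * (6ℚ * ε))) + + 30 / 1 * ε ≡ + 102 / 1 * ε
12η+30ε≡102ε = solve-∀ ℚ-ring

module Payoffs {n} (S : Subset n) (T : Fin n → Subset n) where

  open Construction n S T

  A·_ _·B : (Fin n → ℚ) → Fin n → ℚ
  (A· s) a = Σᶠ n (λ b → A a b * s b)
  (e ·B) b = Σᶠ n (λ a → B a b * e a)

  half₁ half₂ : (Fin (n ℕ.+ n) → ℚ) → Fin n → ℚ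
  half₁ z a = z (a ↑ˡ n)
  half₂ z a = z (n ↑ʳ a)

  Pᵣ Qᵣ : (Fin (n ℕ.+ n) → ℚ) → Fin (n ℕ.+ n) → ℚ
  Pᵣ y i = Σᶠ (n ℕ.+ n) (λ j → R i (swapHalf j) * y j)
  Qᵣ x j = Σᶠ (n ℕ.+ n) (λ i → x i * C i (swapHalf j))

  private
    swap-↑ˡ : ∀ b → swapHalf (b ↑ˡ n) ≡ n ↑ʳ b
    swap-↑ˡ b rewrite splitAt-↑ˡ n b n = refl

    swap-↑ʳ : ∀ b → swapHalf (n ↑ʳ b) ≡ b ↑ˡ n
    swap-↑ʳ b rewrite splitAt-↑ʳ n n b = refl

  R-↑ˡ-↑ˡ : ∀ a b → R (a ↑ˡ n) (swapHalf (b ↑ˡ n)) ≡ - 2ℚ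
  R-↑ˡ-↑ˡ a b rewrite swap-↑ˡ b | splitAt-↑ˡ n a n | splitAt-↑ʳ n n b = refl
  R-↑ˡ-↑ʳ : ∀ a b → R (a ↑ˡ n) (swapHalf (n ↑ʳ b)) ≡ 2ℚ + A a b
  R-↑ˡ-↑ʳ a b rewrite swap-↑ʳ b | splitAt-↑ˡ n a n | splitAt-↑ˡ n b n = refl
  R-↑ʳ-↑ˡ : ∀ a b → R (n ↑ʳ a) (swapHalf (b ↑ˡ n)) ≡ 2ℚ + B b a
  R-↑ʳ-↑ˡ a b rewrite swap-↑ˡ b | splitAt-↑ʳ n n a | splitAt-↑ʳ n n b = refl
  R-↑ʳ-↑ʳ : ∀ a b → R (n ↑ʳ a) (swapHalf (n ↑ʳ b)) ≡ - 2ℚ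
  R-↑ʳ-↑ʳ a b rewrite swap-↑ʳ b | splitAt-↑ʳ n n a | splitAt-↑ˡ n b n = refl
  C-↑ˡ-↑ˡ : ∀ a b → C (a ↑ˡ n) (swapHalf (b ↑ˡ n)) ≡ 2ℚ
  C-↑ˡ-↑ˡ a b rewrite swap-↑ˡ b | splitAt-↑ˡ n a n | splitAt-↑ʳ n n b = refl
  C-↑ˡ-↑ʳ : ∀ a b → C (a ↑ˡ n) (swapHalf (n ↑ʳ b)) ≡ - 2ℚ + B a b
  C-↑ˡ-↑ʳ a b rewrite swap-↑ʳ b | splitAt-↑ˡ n a n | splitAt-↑ˡ n b n = refl
  C-↑ʳ-↑ˡ : ∀ a b → C (n ↑ʳ a) (swapHalf (b ↑ˡ n)) ≡ - 2ℚ + A b a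
  C-↑ʳ-↑ˡ a b rewrite swap-↑ˡ b | splitAt-↑ʳ n n a | splitAt-↑ʳ n n b = refl
  C-↑ʳ-↑ʳ : ∀ a b → C (n ↑ʳ a) (swapHalf (n ↑ʳ b)) ≡ 2ℚ
  C-↑ʳ-↑ʳ a b rewrite swap-↑ʳ b | splitAt-↑ʳ n n a | splitAt-↑ˡ n b n = refl

  private
    -2q+[2p+v] : ∀ p q v → - 2ℚ * q + (2ℚ * p + v) ≡ 2ℚ * p - 2ℚ * q + v
    -2q+[2p+v] = solve-∀ ℚ-ring
    [2p+v]-2q : ∀ p q v → (2ℚ * p + v) + - 2ℚ * q ≡ 2ℚ * p - 2ℚ * q + v
    [2p+v]-2q = solve-∀ ℚ-ring
    2p+[-2q+v] : ∀ p q v → 2ℚ * p + (- 2ℚ * q + v) ≡ 2ℚ * p - 2ℚ * q + v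
    2p+[-2q+v] = solve-∀ ℚ-ring
    [-2q+v]+2p : ∀ p q v → (- 2ℚ * q + v) + 2ℚ * p ≡ 2ℚ * p - 2ℚ * q + v
    [-2q+v]+2p = solve-∀ ℚ-ring

  Pᵣ-↑ˡ : ∀ y a → Pᵣ y (a ↑ˡ n) ≡ gain (Σᶠ n (half₂ y)) (Σᶠ n (half₁ y)) ((A· half₂ y) a)
  Pᵣ-↑ˡ y a = begin
    Pᵣ y (a ↑ˡ n)
      ≡⟨ Σᶠ-↑ n n _ ⟩
    Σᶠ n (λ b → R (a ↑ˡ n) (swapHalf (b ↑ˡ n)) * half₁ y b) + Σᶠ n (λ b → R (a ↑ˡ n) (swapHalf (n ↑ʳ b)) * half₂ y b)
      ≡⟨ cong₂ _+_ (Σᶠ-cong n (λ b → cong (_* _) (R-↑ˡ-↑ˡ a b))) (Σᶠ-cong n (λ b → cong (_* _) (R-↑ˡ-↑ʳ a b))) ⟩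
    Σᶠ n (λ b → - 2ℚ * half₁ y b) + Σᶠ n (λ b → (2ℚ + A a b) * half₂ y b)
      ≡⟨ cong₂ _+_ (Σᶠ-*ˡ (- 2ℚ) (half₁ y)) (Σᶠ-shiftˡ 2ℚ (A a) (half₂ y)) ⟩
    - 2ℚ * Σᶠ n (half₁ y) + (2ℚ * Σᶠ n (half₂ y) + (A· half₂ y) a)
      ≡⟨ -2q+[2p+v] (Σᶠ n (half₂ y)) (Σᶠ n (half₁ y)) ((A· half₂ y) a) ⟩
    gain (Σᶠ n (half₂ y)) (Σᶠ n (half₁ y)) ((A· half₂ y) a) ∎
    where open ≡-Reasoning

  Pᵣ-↑ʳ : ∀ y b → Pᵣ y (n ↑ʳ b) ≡ gain (Σᶠ n (half₁ y)) (Σᶠ n (half₂ y)) ((half₁ y ·B) b)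
  Pᵣ-↑ʳ y b = begin
    Pᵣ y (n ↑ʳ b)
      ≡⟨ Σᶠ-↑ n n _ ⟩
    Σᶠ n (λ a → R (n ↑ʳ b) (swapHalf (a ↑ˡ n)) * half₁ y a) + Σᶠ n (λ a → R (n ↑ʳ b) (swapHalf (n ↑ʳ a)) * half₂ y a)
      ≡⟨ cong₂ _+_ (Σᶠ-cong n (λ a → cong (_* _) (R-↑ʳ-↑ˡ b a))) (Σᶠ-cong n (λ a → cong (_* _) (R-↑ʳ-↑ʳ b a))) ⟩
    Σᶠ n (λ a → (2ℚ + B a b) * half₁ y a) + Σᶠ n (λ a → - 2ℚ * half₂ y a)
      ≡⟨ cong₂ _+_ (Σᶠ-shiftˡ 2ℚ (λ a → B a b) (half₁ y)) (Σᶠ-*ˡ (- 2ℚ) (half₂ y)) ⟩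
    (2ℚ * Σᶠ n (half₁ y) + (half₁ y ·B) b) + - 2ℚ * Σᶠ n (half₂ y)
      ≡⟨ [2p+v]-2q (Σᶠ n (half₁ y)) (Σᶠ n (half₂ y)) ((half₁ y ·B) b) ⟩
    gain (Σᶠ n (half₁ y)) (Σᶠ n (half₂ y)) ((half₁ y ·B) b) ∎
    where open ≡-Reasoning

  Qᵣ-↑ˡ : ∀ x b → Qᵣ x (b ↑ˡ n) ≡ gain (Σᶠ n (half₁ x)) (Σᶠ n (half₂ x)) ((A· half₂ x) b)
  Qᵣ-↑ˡ x b = begin
    Qᵣ x (b ↑ˡ n)
      ≡⟨ Σᶠ-↑ n n _ ⟩
    Σᶠ n (λ a → half₁ x a * C (a ↑ˡ n) (swapHalf (b ↑ˡ n))) + Σᶠ n (λ a → half₂ x a * C (n ↑ʳ a) (swapHalf (b ↑ˡ n)))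
      ≡⟨ cong₂ _+_ (Σᶠ-cong n (λ a → cong (half₁ x a *_) (C-↑ˡ-↑ˡ a b))) (Σᶠ-cong n (λ a → cong (half₂ x a *_) (C-↑ʳ-↑ˡ a b))) ⟩
    Σᶠ n (λ a → half₁ x a * 2ℚ) + Σᶠ n (λ a → half₂ x a * (- 2ℚ + A b a))
      ≡⟨ cong₂ _+_ (trans (Σᶠ-*ʳ (half₁ x) 2ℚ) (*-comm (Σᶠ n (half₁ x)) 2ℚ)) (Σᶠ-shiftʳ (- 2ℚ) (A b) (half₂ x)) ⟩
    2ℚ * Σᶠ n (half₁ x) + (- 2ℚ * Σᶠ n (half₂ x) + (A· half₂ x) b)
      ≡⟨ 2p+[-2q+v] (Σᶠ n (half₁ x)) (Σᶠ n (half₂ x)) ((A· half₂ x) b) ⟩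
    gain (Σᶠ n (half₁ x)) (Σᶠ n (half₂ x)) ((A· half₂ x) b) ∎
    where open ≡-Reasoning

  Qᵣ-↑ʳ : ∀ x b → Qᵣ x (n ↑ʳ b) ≡ gain (Σᶠ n (half₂ x)) (Σᶠ n (half₁ x)) ((half₁ x ·B) b)
  Qᵣ-↑ʳ x b = begin
    Qᵣ x (n ↑ʳ b)
      ≡⟨ Σᶠ-↑ n n _ ⟩
    Σᶠ n (λ a → half₁ x a * C (a ↑ˡ n) (swapHalf (n ↑ʳ b))) + Σᶠ n (λ a → half₂ x a * C (n ↑ʳ a) (swapHalf (n ↑ʳ b)))
      ≡⟨ cong₂ _+_ (Σᶠ-cong n (λ a → cong (half₁ x a *_) (C-↑ˡ-↑ʳ a b))) (Σᶠ-cong n (λ a → cong (half₂ x a *_) (C-↑ʳ-↑ʳ a b))) ⟩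
    Σᶠ n (λ a → half₁ x a * (- 2ℚ + B a b)) + Σᶠ n (λ a → half₂ x a * 2ℚ)
      ≡⟨ cong₂ _+_ (Σᶠ-shiftʳ (- 2ℚ) (λ a → B a b) (half₁ x)) (trans (Σᶠ-*ʳ (half₂ x) 2ℚ) (*-comm (Σᶠ n (half₂ x)) 2ℚ)) ⟩
    (- 2ℚ * Σᶠ n (half₁ x) + (half₁ x ·B) b) + 2ℚ * Σᶠ n (half₂ x)
      ≡⟨ [-2q+v]+2p (Σᶠ n (half₂ x)) (Σᶠ n (half₁ x)) ((half₁ x ·B) b) ⟩
    gain (Σᶠ n (half₂ x)) (Σᶠ n (half₁ x)) ((half₁ x ·B) b) ∎
    where open ≡-Reasoning

  rowPay-R̃ : ∀ y → Σᶠ (n ℕ.+ n) y ≡ 1ℚ → ∀ i → rowPay R̃ y i ≡ (Pᵣ y i + 3ℚ) * (+ 1 / 6)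
  rowPay-R̃ y Σy≡1 i = begin
    Σᶠ (n ℕ.+ n) (λ j → (R i (swapHalf j) + 3ℚ) * (+ 1 / 6) * y j)
      ≡⟨ Σᶠ-cong (n ℕ.+ n) (λ j → rescale (R i (swapHalf j)) (y j)) ⟩
    Σᶠ (n ℕ.+ n) (λ j → (+ 1 / 6) * (R i (swapHalf j) * y j) + ½ * y j)
      ≡⟨ Σᶠ-+ (λ j → (+ 1 / 6) * (R i (swapHalf j) * y j)) (λ j → ½ * y j) ⟩
    Σᶠ (n ℕ.+ n) (λ j → (+ 1 / 6) * (R i (swapHalf j) * y j)) + Σᶠ (n ℕ.+ n) (λ j → ½ * y j)
      ≡⟨ cong₂ _+_ (Σᶠ-*ˡ (+ 1 / 6) (λ j → R i (swapHalf j) * y j)) (trans (Σᶠ-*ˡ ½ y) (cong (½ *_) Σy≡1)) ⟩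
    (+ 1 / 6) * Pᵣ y i + ½ * 1ℚ
      ≡⟨ collect (Pᵣ y i) ⟩
    (Pᵣ y i + 3ℚ) * (+ 1 / 6) ∎
    where
    open ≡-Reasoning
    rescale : ∀ r z → (r + 3ℚ) * (+ 1 / 6) * z ≡ (+ 1 / 6) * (r * z) + ½ * z
    rescale = solve-∀ ℚ-ring
    collect : ∀ p → (+ 1 / 6) * p + ½ * 1ℚ ≡ (p + 3ℚ) * (+ 1 / 6)
    collect = solve-∀ ℚ-ring

  colPay-C̃ : ∀ x → Σᶠ (n ℕ.+ n) x ≡ 1ℚ → ∀ j → colPay C̃ x j ≡ (Qᵣ x j + 3ℚ) * (+ 1 / 6)
  colPay-C̃ x Σx≡1 j = begin
    Σᶠ (n ℕ.+ n) (λ i → x i * ((C i (swapHalf j) + 3ℚ) * (+ 1 / 6)))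
      ≡⟨ Σᶠ-cong (n ℕ.+ n) (λ i → rescale (C i (swapHalf j)) (x i)) ⟩
    Σᶠ (n ℕ.+ n) (λ i → (+ 1 / 6) * (x i * C i (swapHalf j)) + ½ * x i)
      ≡⟨ Σᶠ-+ (λ i → (+ 1 / 6) * (x i * C i (swapHalf j))) (λ i → ½ * x i) ⟩
    Σᶠ (n ℕ.+ n) (λ i → (+ 1 / 6) * (x i * C i (swapHalf j))) + Σᶠ (n ℕ.+ n) (λ i → ½ * x i)
      ≡⟨ cong₂ _+_ (Σᶠ-*ˡ (+ 1 / 6) (λ i → x i * C i (swapHalf j))) (trans (Σᶠ-*ˡ ½ x) (cong (½ *_) Σx≡1)) ⟩
    (+ 1 / 6) * Qᵣ x j + ½ * 1ℚ
      ≡⟨ collect (Qᵣ x j) ⟩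
    (Qᵣ x j + 3ℚ) * (+ 1 / 6) ∎
    where
    open ≡-Reasoning
    rescale : ∀ r z → z * ((r + 3ℚ) * (+ 1 / 6)) ≡ (+ 1 / 6) * (z * r) + ½ * z
    rescale = solve-∀ ℚ-ring
    collect : ∀ p → (+ 1 / 6) * p + ½ * 1ℚ ≡ (p + 3ℚ) * (+ 1 / 6)
    collect = solve-∀ ℚ-ring

inv-cancel : ∀ k → inv (suc k) * ℕ→ℚ (suc k) ≡ 1ℚ
inv-cancel k = trans (cong₂ _*_ (↥p/↧p≡p (mkℚ (+ 1) k (C.1-coprimeTo (suc k)))) (ℕ→ℚ≡mkℚ (suc k)))
                     (*-inverseˡ (mkℚ (+ suc k) 0 (C.sym (C.1-coprimeTo (suc k)))))

inv[m+m]*m≡½ : ∀ m → 1 ℕ.≤ m → inv (m ℕ.+ m) * ℕ→ℚ m ≡ ½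
inv[m+m]*m≡½ (suc k) _ = begin
  inv (suc k ℕ.+ suc k) * ℕ→ℚ (suc k)                          ≡⟨ halve (inv (suc k ℕ.+ suc k)) (ℕ→ℚ (suc k)) ⟩
  ½ * (inv (suc k ℕ.+ suc k) * (ℕ→ℚ (suc k) + ℕ→ℚ (suc k)))   ≡⟨ cong (λ t → ½ * (inv (suc k ℕ.+ suc k) * t)) (ℕ→ℚ-+ (suc k) (suc k)) ⟨
  ½ * (inv (suc k ℕ.+ suc k) * ℕ→ℚ (suc k ℕ.+ suc k))         ≡⟨ cong (½ *_) (inv-cancel (k ℕ.+ suc k)) ⟩
  ½ * 1ℚ                                                      ≡⟨ *-identityʳ ½ ⟩
  ½                                                           ∎
  where
  open ≡-Reasoning
  halve : ∀ c x → c * x ≡ ½ * (c * (x + x))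
  halve = solve-∀ ℚ-ring

module Structure {n} (m : ℕ) (S : Subset n) (T : Fin n → Subset n)
  (∣S∣≡2m : ∣ S ∣ ≡ m ℕ.+ m) (m≥1 : 1 ℕ.≤ m)
  (T⊆S : ∀ b → T b ⊆ S) (∣T∣≡m : ∀ b → ∣ T b ∣ ≡ m)
  (T-onto : ∀ U → U ⊆ S → ∣ U ∣ ≡ m → ∃ λ b → T b ≡ U) where

  open Construction n S T
  open Payoffs S T

  u : Fin n → ℚ
  u = uCoord S

  κ : ℚ
  κ = inv ∣ S ∣

  κ*m≡½ : κ * ℕ→ℚ m ≡ ½
  κ*m≡½ = subst (λ s → inv s * ℕ→ℚ m ≡ ½) (sym ∣S∣≡2m) (inv[m+m]*m≡½ m m≥1)

  κ-nonNeg : 0ℚ ≤ κ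
  κ-nonNeg with ∣ S ∣
  ... | zero  = ≤-refl
  ... | suc k = <⇒≤ (positive⁻¹ (+ 1 / suc k) {{normalize-pos 1 (suc k)}})

  u-nonNeg : ∀ a → 0ℚ ≤ u a
  u-nonNeg a with mem S a
  ... | true  = κ-nonNeg
  ... | false = ≤-refl

  Σ∈u≡½ : ∀ U → U ⊆ S → ∣ U ∣ ≡ m → Σ∈ U u ≡ ½
  Σ∈u≡½ U U⊆S ∣U∣≡m = begin
    Σ∈ U u                ≡⟨ Σᶠ-cong n pointwise ⟩
    Σ∈ U (λ _ → κ)        ≡⟨ Σ∈-const U κ ⟩
    ℕ→ℚ ∣ U ∣ * κ          ≡⟨ cong (λ k → ℕ→ℚ k * κ) ∣U∣≡m ⟩
    ℕ→ℚ m * κ             ≡⟨ *-comm (ℕ→ℚ m) κ ⟩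
    κ * ℕ→ℚ m             ≡⟨ κ*m≡½ ⟩
    ½                     ∎
    where
    open ≡-Reasoning
    pointwise : ∀ a → restrict U u a ≡ restrict U (λ _ → κ) a
    pointwise a with mem U a in a∈U
    ... | false = refl
    ... | true  rewrite ⊆-mem U⊆S a∈U = refl

  Σu≡1 : Σᶠ n u ≡ 1ℚ
  Σu≡1 = begin
    Σ∈ S (λ _ → κ)                ≡⟨ Σ∈-const S κ ⟩
    ℕ→ℚ ∣ S ∣ * κ                  ≡⟨ cong (λ k → ℕ→ℚ k * κ) ∣S∣≡2m ⟩
    ℕ→ℚ (m ℕ.+ m) * κ             ≡⟨ cong (_* κ) (ℕ→ℚ-+ m m) ⟩
    (ℕ→ℚ m + ℕ→ℚ m) * κ           ≡⟨ *-distribʳ-+ κ (ℕ→ℚ m) (ℕ→ℚ m) ⟩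
    ℕ→ℚ m * κ + ℕ→ℚ m * κ         ≡⟨ cong (λ t → t + t) (trans (*-comm (ℕ→ℚ m) κ) κ*m≡½) ⟩
    ½ + ½                         ∎
    where open ≡-Reasoning

  T-outside : ∀ b {a} → mem S a ≡ false → mem (T b) a ≡ false
  T-outside b {a} a∉S with mem (T b) a in a∈T
  ... | false = refl
  ... | true  = trans (sym (⊆-mem (T⊆S b) a∈T)) a∉S

  ·B≡Σ-Σ∈T : ∀ e b → (e ·B) b ≡ Σᶠ n e - Σ∈ (T b) e
  ·B≡Σ-Σ∈T e b = trans (Σᶠ-cong n pointwise) (Σᶠ-- e (restrict (T b) e))
    where
    pointwise : ∀ a → B a b * e a ≡ e a - restrict (T b) e a
    pointwise a with mem S a in a∈S | mem (T b) a in a∈T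
    ... | true  | true  = trans (*-zeroˡ (e a)) (sym (+-inverseʳ (e a)))
    ... | true  | false = trans (*-identityˡ (e a)) (sym (+-identityʳ (e a)))
    ... | false | false = trans (*-identityˡ (e a)) (sym (+-identityʳ (e a)))
    ... | false | true  = contradiction (trans (sym (T-outside b a∈S)) a∈T) λ ()

  A·-outside : ∀ s {a} → mem S a ≡ false → (A· s) a ≡ - Σᶠ n s
  A·-outside s {a} a∉S = trans (Σᶠ-cong n pointwise) (Σᶠ-neg n s)
    where
    pointwise : ∀ b → A a b * s b ≡ - s b
    pointwise b rewrite a∉S = trans (sym (neg-distribˡ-* 1ℚ (s b))) (cong -_ (*-identityˡ (s b)))

  A·-nonNeg : ∀ s {a} → (∀ b → 0ℚ ≤ s b) → mem S a ≡ true → 0ℚ ≤ (A· s) a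
  A·-nonNeg s {a} s≥0 a∈S = Σᶠ-nonNeg n pointwise
    where
    pointwise : ∀ b → 0ℚ ≤ A a b * s b
    pointwise b rewrite a∈S with mem (T b) a
    ... | true  = scale 1ℚ (s≥0 b)
    ... | false = scale 0ℚ (s≥0 b)

  A·≤Σ : ∀ s a → (∀ b → 0ℚ ≤ s b) → (A· s) a ≤ Σᶠ n s
  A·≤Σ s a s≥0 = Σᶠ-mono-≤ n pointwise
    where
    pointwise : ∀ b → A a b * s b ≤ s b
    pointwise b with mem S a
    ... | false = ≤-trans (≤-reflexive (trans (sym (neg-distribˡ-* 1ℚ (s b))) (cong -_ (*-identityˡ (s b)))))
                          (≤-trans (neg-antimono-≤ (s≥0 b)) (s≥0 b))
    ... | true with mem (T b) a
    ... | true  = ≤-reflexive (*-identityˡ (s b))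
    ... | false = subst (_≤ s b) (sym (*-zeroˡ (s b))) (s≥0 b)

  ·B-nonNeg : ∀ e b → (∀ a → 0ℚ ≤ e a) → 0ℚ ≤ (e ·B) b
  ·B-nonNeg e b e≥0 = Σᶠ-nonNeg n pointwise
    where
    B-nonNeg : ∀ a → 0ℚ ≤ B a b
    B-nonNeg a with mem S a
    ... | false = decide-≤ tt
    ... | true with mem (T b) a
    ... | true  = ≤-refl
    ... | false = decide-≤ tt
    pointwise : ∀ a → 0ℚ ≤ B a b * e a
    pointwise a = *-nonNeg (B-nonNeg a) (e≥0 a)

  ·B≤Σ : ∀ e b → (∀ a → 0ℚ ≤ e a) → (e ·B) b ≤ Σᶠ n e
  ·B≤Σ e b e≥0 = Σᶠ-mono-≤ n pointwise
    where
    pointwise : ∀ a → B a b * e a ≤ e a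
    pointwise a with mem S a
    ... | false = ≤-reflexive (*-identityˡ (e a))
    ... | true with mem (T b) a
    ... | true  = subst (_≤ e a) (sym (*-zeroˡ (e a))) (e≥0 a)
    ... | false = ≤-reflexive (*-identityˡ (e a))

  Σu·A≡½Σ : ∀ s → Σᶠ n (λ a → u a * (A· s) a) ≡ ½ * Σᶠ n s
  Σu·A≡½Σ s = begin
    Σᶠ n (λ a → u a * Σᶠ n (λ b → A a b * s b))     ≡⟨ Σᶠ-cong n (λ a → sym (Σᶠ-*ˡ (u a) (λ b → A a b * s b))) ⟩
    Σᶠ n (λ a → Σᶠ n (λ b → u a * (A a b * s b)))   ≡⟨ Σᶠ-comm (λ a b → u a * (A a b * s b)) ⟩
    Σᶠ n (λ b → Σᶠ n (λ a → u a * (A a b * s b)))   ≡⟨ Σᶠ-cong n (λ b → Σᶠ-cong n (λ a → sym (*-assoc (u a) (A a b) (s b)))) ⟩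
    Σᶠ n (λ b → Σᶠ n (λ a → u a * A a b * s b))     ≡⟨ Σᶠ-cong n (λ b → Σᶠ-*ʳ (λ a → u a * A a b) (s b)) ⟩
    Σᶠ n (λ b → Σᶠ n (λ a → u a * A a b) * s b)     ≡⟨ Σᶠ-cong n (λ b → cong (_* s b) (column-mass b)) ⟩
    Σᶠ n (λ b → ½ * s b)                            ≡⟨ Σᶠ-*ˡ ½ s ⟩
    ½ * Σᶠ n s                                      ∎
    where
    open ≡-Reasoning
    column-mass : ∀ b → Σᶠ n (λ a → u a * A a b) ≡ ½
    column-mass b = trans (Σᶠ-cong n pointwise) (Σ∈u≡½ (T b) (T⊆S b) (∣T∣≡m b))
      where
      pointwise : ∀ a → u a * A a b ≡ restrict (T b) u a
      pointwise a with mem S a in a∈S | mem (T b) a in a∈T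
      ... | true  | true  = *-identityʳ κ
      ... | true  | false = *-zeroʳ κ
      ... | false | false = refl
      ... | false | true  = contradiction (trans (sym (T-outside b a∈S)) a∈T) λ ()

  Σe·A≡Σs·Σ∈T : ∀ e s → VanishesOutside S e →
                Σᶠ n (λ a → e a * (A· s) a) ≡ Σᶠ n (λ b → s b * Σ∈ (T b) e)
  Σe·A≡Σs·Σ∈T e s e-outside = begin
    Σᶠ n (λ a → e a * Σᶠ n (λ b → A a b * s b))     ≡⟨ Σᶠ-cong n (λ a → sym (Σᶠ-*ˡ (e a) (λ b → A a b * s b))) ⟩
    Σᶠ n (λ a → Σᶠ n (λ b → e a * (A a b * s b)))   ≡⟨ Σᶠ-comm (λ a b → e a * (A a b * s b)) ⟩
    Σᶠ n (λ b → Σᶠ n (λ a → e a * (A a b * s b)))   ≡⟨ Σᶠ-cong n (λ b → Σᶠ-cong n (pointwise b)) ⟩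
    Σᶠ n (λ b → Σᶠ n (λ a → s b * restrict (T b) e a))  ≡⟨ Σᶠ-cong n (λ b → Σᶠ-*ˡ (s b) (restrict (T b) e)) ⟩
    Σᶠ n (λ b → s b * Σ∈ (T b) e)                   ∎
    where
    open ≡-Reasoning
    x*[1*y]≡y*x : ∀ x y → x * (1ℚ * y) ≡ y * x
    x*[1*y]≡y*x = solve-∀ ℚ-ring
    x*[c*y]≡y*0 : ∀ c x y → c ≡ 0ℚ ⊎ x ≡ 0ℚ → x * (c * y) ≡ y * 0ℚ
    x*[c*y]≡y*0 c x y (inj₁ refl) = trans (cong (x *_) (*-zeroˡ y)) (trans (*-zeroʳ x) (sym (*-zeroʳ y)))
    x*[c*y]≡y*0 c x y (inj₂ refl) = trans (*-zeroˡ (c * y)) (sym (*-zeroʳ y))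
    pointwise : ∀ b a → e a * (A a b * s b) ≡ s b * restrict (T b) e a
    pointwise b a with mem S a in a∈S | mem (T b) a in a∈T
    ... | true  | true  = x*[1*y]≡y*x (e a) (s b)
    ... | true  | false = x*[c*y]≡y*0 0ℚ (e a) (s b) (inj₁ refl)
    ... | false | false = x*[c*y]≡y*0 (- 1ℚ) (e a) (s b) (inj₂ (e-outside a a∈S))
    ... | false | true  = contradiction (trans (sym (T-outside b a∈S)) a∈T) λ ()

  ∣S∩∁T∣≡m : ∀ b → ∣ S ∩ ∁ (T b) ∣ ≡ m
  ∣S∩∁T∣≡m b = ℕ.+-cancelʳ-≡ m _ m (trans (cong (_ ℕ.+_) (sym (∣T∣≡m b))) (trans (∣p∩∁q∣+∣q∣≡∣p∣ (T⊆S b)) ∣S∣≡2m))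

  complement : ∀ e → VanishesOutside S e → ∀ b → ∃ λ b′ → Σ∈ (T b) e + Σ∈ (T b′) e ≡ Σᶠ n e
  complement e e-outside b with b′ , T[b′]≡S∖T[b] ← T-onto (S ∩ ∁ (T b)) (p∩q⊆p S _) (∣S∩∁T∣≡m b)
    = b′ , (begin
      Σ∈ (T b) e + Σ∈ (T b′) e                ≡⟨ cong (λ U → Σ∈ (T b) e + Σ∈ U e) T[b′]≡S∖T[b] ⟩
      Σ∈ (T b) e + Σ∈ (S ∩ ∁ (T b)) e         ≡⟨ Σᶠ-+ (restrict (T b) e) (restrict (S ∩ ∁ (T b)) e) ⟨
      Σᶠ n (λ a → restrict (T b) e a + restrict (S ∩ ∁ (T b)) e a)  ≡⟨ Σᶠ-cong n pointwise ⟩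
      Σᶠ n e                                  ∎)
    where
    open ≡-Reasoning
    pointwise : ∀ a → restrict (T b) e a + restrict (S ∩ ∁ (T b)) e a ≡ e a
    pointwise a rewrite mem-∩ S (∁ (T b)) a | mem-∁ (T b) a with mem S a in a∈S
    ... | false rewrite T-outside b a∈S = sym (e-outside a a∈S)
    ... | true with mem (T b) a
    ... | true  = +-identityʳ (e a)
    ... | false = +-identityˡ (e a)

  Σ[c*u]≡c : ∀ c → Σᶠ n (λ a → c * u a) ≡ c
  Σ[c*u]≡c c = trans (Σᶠ-*ˡ c u) (trans (cong (c *_) Σu≡1) (*-identityʳ c))

  average≤ : ∀ (g : Fin n → ℚ) v → (∀ k → g k ≤ v) → Σᶠ n (λ k → u k * g k) ≤ v
  average≤ g v g≤v = begin
    Σᶠ n (λ k → u k * g k)   ≤⟨ Σᶠ-mono-≤ n (λ k → *-monoˡ-≤-nonNeg (u k) {{nonNegative (u-nonNeg k)}} (g≤v k)) ⟩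
    Σᶠ n (λ k → u k * v)     ≡⟨ Σᶠ-*ʳ u v ⟩
    Σᶠ n u * v               ≡⟨ cong (_* v) Σu≡1 ⟩
    1ℚ * v                   ≡⟨ *-identityˡ v ⟩
    v                        ∎
    where open ≤-Reasoning

  -- One player's mass e on elements against the other's mass s on the subsets T b.
  module Subgame (e s : Fin n → ℚ) (e≥0 : ∀ a → 0ℚ ≤ e a) (s≥0 : ∀ b → 0ℚ ≤ s b)
    (e-outside : VanishesOutside S e) (b₀ : Fin n) (η : ℚ) (η≥0 : 0ℚ ≤ η)
    (e-best : ∀ a → 0ℚ < e a → ½ * Σᶠ n s ≤ (A· s) a + η)
    (s-best : ∀ b → 0ℚ < s b → ∀ b′ → Σ∈ (T b) e ≤ Σ∈ (T b′) e + η)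
    (⅓≤Σs : ⅓ ≤ Σᶠ n s) (Σe≤⅔ : Σᶠ n e ≤ ⅔) where

    E Sm W : ℚ
    E  = Σᶠ n e
    Sm = Σᶠ n s
    W  = Σᶠ n (λ b → s b * Σ∈ (T b) e)

    W-lower : E * (½ * Sm) ≤ W + E * η
    W-lower = begin
      E * (½ * Sm)                          ≡⟨ Σᶠ-*ʳ e (½ * Sm) ⟨
      Σᶠ n (λ a → e a * (½ * Sm))           ≤⟨ Σᶠ-weighted-≤ n e (λ _ → ½ * Sm) (λ a → (A· s) a + η) e≥0 e-best ⟩
      Σᶠ n (λ a → e a * ((A· s) a + η))     ≡⟨ Σᶠ-weighted-+ e (A· s) η ⟩
      Σᶠ n (λ a → e a * (A· s) a) + E * η   ≡⟨ cong (_+ E * η) (Σe·A≡Σs·Σ∈T e s e-outside) ⟩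
      W + E * η                             ∎
      where open ≤-Reasoning

    light-subset : ∃ λ b → Σ∈ (T b) e ≤ ½ * E
    light-subset with b′ , sum≡E ← complement e e-outside b₀ with Σ∈ (T b₀) e ≤? ½ * E
    ... | yes light = b₀ , light
    ... | no  heavy = b′ , complement-light sum≡E (<⇒≤ (≰⇒> heavy))

    W-upper : ∀ b′ → W ≤ Sm * (Σ∈ (T b′) e + η)
    W-upper b′ = begin
      W                                        ≤⟨ Σᶠ-weighted-≤ n s _ (λ _ → Σ∈ (T b′) e + η) s≥0 (λ b s>0 → s-best b s>0 b′) ⟩
      Σᶠ n (λ b → s b * (Σ∈ (T b′) e + η))     ≡⟨ Σᶠ-*ʳ s _ ⟩
      Sm * (Σ∈ (T b′) e + η)                   ∎
      where open ≤-Reasoning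

    W-upper-½ : W ≤ Sm * (½ * E + η)
    W-upper-½ = ≤-trans (W-upper (proj₁ light-subset))
                  (*-monoˡ-≤-nonNeg Sm {{nonNegative (≤-trans (decide-≤ tt) ⅓≤Σs)}} (+-monoˡ-≤ η (proj₂ light-subset)))

    Σ∈T-lower : ∀ b → ½ * E - 3ℚ * η ≤ Σ∈ (T b) e
    Σ∈T-lower b = subset-mass-lower (W-upper b) W-lower η≥0 ⅓≤Σs Σe≤⅔

    Σ∈T-upper : ∀ b → Σ∈ (T b) e ≤ ½ * E + 3ℚ * η
    Σ∈T-upper b with b′ , sum≡E ← complement e e-outside b = subset-mass-upper {η = η} sum≡E (Σ∈T-lower b′)

    f : Fin n → ℚ
    f a = e a - E * u a

    Σ∣f∣≤12η : Σᶠ n (λ a → abs (f a)) ≤ (3ℚ * η + 3ℚ * η) + (3ℚ * η + 3ℚ * η)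
    Σ∣f∣≤12η = Σ∣f∣≤4δ m S ∣S∣≡2m f f-outside Σf≡0 (3ℚ * η) half-sums
      where
      f-outside : VanishesOutside S f
      f-outside a a∉S rewrite e-outside a a∉S | a∉S = cong (_-_ 0ℚ) (*-zeroʳ E)
      Σf≡0 : Σᶠ n f ≡ 0ℚ
      Σf≡0 = trans (Σᶠ-- e (λ a → E * u a)) (trans (cong (_-_ E) (Σ[c*u]≡c E)) (+-inverseʳ E))
      half-sums : ∀ U → U ⊆ S → ∣ U ∣ ≡ m → abs (Σ∈ U f) ≤ 3ℚ * η
      half-sums U U⊆S ∣U∣≡m with b , T[b]≡U ← T-onto U U⊆S ∣U∣≡m rewrite sym T[b]≡U =
        subst (λ t → abs t ≤ 3ℚ * η) (sym Σ∈T[f]≡) (∣t-½E∣≤δ {E = E} (Σ∈T-lower b) (Σ∈T-upper b))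
        where
        Σ∈T[f]≡ : Σ∈ (T b) f ≡ Σ∈ (T b) e - E * ½
        Σ∈T[f]≡ = trans (Σ∈-affine (T b) e E u) (cong (λ t → Σ∈ (T b) e - E * t) (Σ∈u≡½ (T b) U⊆S ∣U∣≡m))

    distance-to-uniform : ∀ ρ → abs (E - ½) ≤ ρ →
      Σᶠ n (λ a → abs (e a - ½ * u a)) ≤ ((3ℚ * η + 3ℚ * η) + (3ℚ * η + 3ℚ * η)) + ρ
    distance-to-uniform ρ ∣E-½∣≤ρ = begin
      Σᶠ n (λ a → abs (e a - ½ * u a))                   ≤⟨ Σᶠ-mono-≤ n triangle ⟩
      Σᶠ n (λ a → abs (f a) + abs (E - ½) * u a)         ≡⟨ Σᶠ-+ (λ a → abs (f a)) (λ a → abs (E - ½) * u a) ⟩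
      Σᶠ n (λ a → abs (f a)) + Σᶠ n (λ a → abs (E - ½) * u a)  ≡⟨ cong (_+_ (Σᶠ n (λ a → abs (f a)))) (Σ[c*u]≡c (abs (E - ½))) ⟩
      Σᶠ n (λ a → abs (f a)) + abs (E - ½)               ≤⟨ +-mono-≤ Σ∣f∣≤12η ∣E-½∣≤ρ ⟩
      ((3ℚ * η + 3ℚ * η) + (3ℚ * η + 3ℚ * η)) + ρ        ∎
      where
      open ≤-Reasoning
      split : ∀ x E u → x - ½ * u ≡ (x - E * u) + (E - ½) * u
      split = solve-∀ ℚ-ring
      triangle : ∀ a → abs (e a - ½ * u a) ≤ abs (f a) + abs (E - ½) * u a
      triangle a = subst₂ _≤_ (cong abs (sym (split (e a) E (u a))))
                     (cong (_+_ (abs (f a))) (trans (∣p*q∣≡∣p∣*∣q∣ (E - ½) (u a)) (cong (abs (E - ½) *_) (0≤p⇒∣p∣≡p (u-nonNeg a)))))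
                     (∣p+q∣≤∣p∣+∣q∣ (f a) ((E - ½) * u a))

module Equilibrium {n} (m : ℕ) (S : Subset n) (T : Fin n → Subset n)
  (∣S∣≡2m : ∣ S ∣ ≡ m ℕ.+ m) (m≥1 : 1 ℕ.≤ m)
  (T⊆S : ∀ b → T b ⊆ S) (∣T∣≡m : ∀ b → ∣ T b ∣ ≡ m)
  (T-onto : ∀ U → U ⊆ S → ∣ U ∣ ≡ m → ∃ λ b → T b ≡ U)
  (s₀ : Fin n) (s₀∈S : mem S s₀ ≡ true)
  (ε : ℚ) (0≤ε : 0ℚ ≤ ε) (ε<1/26 : ε < + 1 / 26)
  (x y : Fin (n ℕ.+ n) → ℚ) (wne : IsWNE (Construction.R̃ n S T) (Construction.C̃ n S T) ε x y) where

  open Construction n S T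
  open Payoffs S T
  open Structure m S T ∣S∣≡2m m≥1 T⊆S ∣T∣≡m T-onto

  x₁ x₂ y₁ y₂ : Fin n → ℚ
  x₁ = half₁ x
  x₂ = half₂ x
  y₁ = half₁ y
  y₂ = half₂ y

  X₁ X₂ Y₁ Y₂ : ℚ
  X₁ = Σᶠ n x₁
  X₂ = Σᶠ n x₂
  Y₁ = Σᶠ n y₁
  Y₂ = Σᶠ n y₂

  η : ℚ
  η = 6ℚ * ε

  0≤η : 0ℚ ≤ η
  0≤η = scale 6ℚ 0≤ε

  x₁≥0 : ∀ a → 0ℚ ≤ x₁ a
  x₁≥0 a = proj₁ (proj₁ wne) (a ↑ˡ n)
  x₂≥0 : ∀ a → 0ℚ ≤ x₂ a
  x₂≥0 a = proj₁ (proj₁ wne) (n ↑ʳ a)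
  y₁≥0 : ∀ a → 0ℚ ≤ y₁ a
  y₁≥0 a = proj₁ (proj₁ (proj₂ wne)) (a ↑ˡ n)
  y₂≥0 : ∀ a → 0ℚ ≤ y₂ a
  y₂≥0 a = proj₁ (proj₁ (proj₂ wne)) (n ↑ʳ a)

  X₁+X₂≡1 : X₁ + X₂ ≡ 1ℚ
  X₁+X₂≡1 = trans (sym (Σᶠ-↑ n n x)) (proj₂ (proj₁ wne))
  Y₁+Y₂≡1 : Y₁ + Y₂ ≡ 1ℚ
  Y₁+Y₂≡1 = trans (sym (Σᶠ-↑ n n y)) (proj₂ (proj₁ (proj₂ wne)))
  X₂+X₁≡1 : X₂ + X₁ ≡ 1ℚ
  X₂+X₁≡1 = trans (+-comm X₂ X₁) X₁+X₂≡1
  Y₂+Y₁≡1 : Y₂ + Y₁ ≡ 1ℚ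
  Y₂+Y₁≡1 = trans (+-comm Y₂ Y₁) Y₁+Y₂≡1

  row-best : ∀ {i k p q} → 0ℚ < x i → Pᵣ y k ≡ p → Pᵣ y i ≡ q → p - η ≤ q
  row-best {i} {k} 0<xi refl refl =
    unscale {Pᵣ y k} {Pᵣ y i} (subst₂ (λ a b → a - ε ≤ b) (rowPay-R̃ y Σy≡1 k) (rowPay-R̃ y Σy≡1 i)
                                      (proj₁ (proj₂ (proj₂ wne)) i 0<xi k))
    where Σy≡1 = proj₂ (proj₁ (proj₂ wne))

  col-best : ∀ {j k p q} → 0ℚ < y j → Qᵣ x k ≡ p → Qᵣ x j ≡ q → p - η ≤ q
  col-best {j} {k} 0<yj refl refl =
    unscale {Qᵣ x k} {Qᵣ x j} (subst₂ (λ a b → a - ε ≤ b) (colPay-C̃ x Σx≡1 k) (colPay-C̃ x Σx≡1 j)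
                                      (proj₂ (proj₂ (proj₂ wne)) j 0<yj k))
    where Σx≡1 = proj₂ (proj₁ wne)

  -- ᴱ: the pure strategy of an element a (index a ↑ˡ n); ˢ: that of a subset T b (index n ↑ʳ b).
  rowᴱ≥ᴱ : ∀ a → 0ℚ < x₁ a → ∀ k → (A· y₂) k ≤ (A· y₂) a + η
  rowᴱ≥ᴱ a 0<x₁a k = gain-cancel {Y₂} {Y₁} (row-best 0<x₁a (Pᵣ-↑ˡ y k) (Pᵣ-↑ˡ y a))
  rowᴱ≥ˢ : ∀ a → 0ℚ < x₁ a → ∀ k → gain Y₁ Y₂ ((y₁ ·B) k) - η ≤ gain Y₂ Y₁ ((A· y₂) a)
  rowᴱ≥ˢ a 0<x₁a k = row-best 0<x₁a (Pᵣ-↑ʳ y k) (Pᵣ-↑ˡ y a)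
  rowˢ≥ˢ : ∀ b → 0ℚ < x₂ b → ∀ k → (y₁ ·B) k ≤ (y₁ ·B) b + η
  rowˢ≥ˢ b 0<x₂b k = gain-cancel {Y₁} {Y₂} (row-best 0<x₂b (Pᵣ-↑ʳ y k) (Pᵣ-↑ʳ y b))
  rowˢ≥ᴱ : ∀ b → 0ℚ < x₂ b → ∀ k → gain Y₂ Y₁ ((A· y₂) k) - η ≤ gain Y₁ Y₂ ((y₁ ·B) b)
  rowˢ≥ᴱ b 0<x₂b k = row-best 0<x₂b (Pᵣ-↑ˡ y k) (Pᵣ-↑ʳ y b)
  colᴱ≥ᴱ : ∀ b → 0ℚ < y₁ b → ∀ k → (A· x₂) k ≤ (A· x₂) b + η
  colᴱ≥ᴱ b 0<y₁b k = gain-cancel {X₁} {X₂} (col-best 0<y₁b (Qᵣ-↑ˡ x k) (Qᵣ-↑ˡ x b))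
  colᴱ≥ˢ : ∀ b → 0ℚ < y₁ b → ∀ k → gain X₂ X₁ ((x₁ ·B) k) - η ≤ gain X₁ X₂ ((A· x₂) b)
  colᴱ≥ˢ b 0<y₁b k = col-best 0<y₁b (Qᵣ-↑ʳ x k) (Qᵣ-↑ˡ x b)
  colˢ≥ˢ : ∀ b → 0ℚ < y₂ b → ∀ k → (x₁ ·B) k ≤ (x₁ ·B) b + η
  colˢ≥ˢ b 0<y₂b k = gain-cancel {X₂} {X₁} (col-best 0<y₂b (Qᵣ-↑ʳ x k) (Qᵣ-↑ʳ x b))
  colˢ≥ᴱ : ∀ b → 0ℚ < y₂ b → ∀ k → gain X₁ X₂ ((A· x₂) k) - η ≤ gain X₂ X₁ ((x₁ ·B) b)
  colˢ≥ᴱ b 0<y₂b k = col-best 0<y₂b (Qᵣ-↑ˡ x k) (Qᵣ-↑ʳ x b)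

  X₁≤0-if-Y₂<⅓ : Y₂ < ⅓ → X₁ ≤ 0ℚ
  X₁≤0-if-Y₂<⅓ Y₂<⅓ = Σᶠ-nonPos n λ a → nonNeg-not-pos (x₁≥0 a) λ 0<x₁a →
    light-side-loses {Y₂} {Y₁} Y₂+Y₁≡1 (rowᴱ≥ˢ a 0<x₁a s₀)
      (≤-trans (A·≤Σ y₂ a y₂≥0) (mass≤1 Y₂+Y₁≡1 (Σᶠ-nonNeg n y₁≥0))) (·B-nonNeg y₁ s₀ y₁≥0) Y₂<⅓ ε<1/26

  Y₁≤0-if-X₁<⅓ : X₁ < ⅓ → Y₁ ≤ 0ℚ
  Y₁≤0-if-X₁<⅓ X₁<⅓ = Σᶠ-nonPos n λ b → nonNeg-not-pos (y₁≥0 b) λ 0<y₁b →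
    light-side-loses {X₁} {X₂} X₁+X₂≡1 (colᴱ≥ˢ b 0<y₁b s₀)
      (≤-trans (A·≤Σ x₂ b x₂≥0) (mass≤1 X₂+X₁≡1 (Σᶠ-nonNeg n x₁≥0))) (·B-nonNeg x₁ s₀ x₁≥0) X₁<⅓ ε<1/26

  X₂≤0-if-Y₁<⅓ : Y₁ < ⅓ → X₂ ≤ 0ℚ
  X₂≤0-if-Y₁<⅓ Y₁<⅓ = Σᶠ-nonPos n λ b → nonNeg-not-pos (x₂≥0 b) λ 0<x₂b →
    light-side-loses {Y₁} {Y₂} Y₁+Y₂≡1 (rowˢ≥ᴱ b 0<x₂b s₀)
      (≤-trans (·B≤Σ y₁ b y₁≥0) (mass≤1 Y₁+Y₂≡1 (Σᶠ-nonNeg n y₂≥0))) (A·-nonNeg y₂ y₂≥0 s₀∈S) Y₁<⅓ ε<1/26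

  Y₂≤0-if-X₂<⅓ : X₂ < ⅓ → Y₂ ≤ 0ℚ
  Y₂≤0-if-X₂<⅓ X₂<⅓ = Σᶠ-nonPos n λ b → nonNeg-not-pos (y₂≥0 b) λ 0<y₂b →
    light-side-loses {X₂} {X₁} X₂+X₁≡1 (colˢ≥ᴱ b 0<y₂b s₀)
      (≤-trans (·B≤Σ x₁ b x₁≥0) (mass≤1 X₁+X₂≡1 (Σᶠ-nonNeg n x₂≥0))) (A·-nonNeg x₂ x₂≥0 s₀∈S) X₂<⅓ ε<1/26

  ⅓≤Y₂ : ⅓ ≤ Y₂
  ⅓≤Y₂ = ≮⇒≥ λ Y₂<⅓ → mass-split-⊥ Y₁+Y₂≡1 (Y₁≤0-if-X₁<⅓ (≤-<-trans (X₁≤0-if-Y₂<⅓ Y₂<⅓) (decide-< tt))) Y₂<⅓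

  ⅓≤Y₁ : ⅓ ≤ Y₁
  ⅓≤Y₁ = ≮⇒≥ λ Y₁<⅓ → mass-split-⊥ Y₂+Y₁≡1 (Y₂≤0-if-X₂<⅓ (≤-<-trans (X₂≤0-if-Y₁<⅓ Y₁<⅓) (decide-< tt))) Y₁<⅓

  ⅓≤X₁ : ⅓ ≤ X₁
  ⅓≤X₁ = ≮⇒≥ λ X₁<⅓ → <-irrefl refl (<-≤-trans (decide-< {0ℚ} {⅓} tt) (≤-trans ⅓≤Y₁ (Y₁≤0-if-X₁<⅓ X₁<⅓)))

  ⅓≤X₂ : ⅓ ≤ X₂
  ⅓≤X₂ = ≮⇒≥ λ X₂<⅓ → <-irrefl refl (<-≤-trans (decide-< {0ℚ} {⅓} tt) (≤-trans ⅓≤Y₂ (Y₂≤0-if-X₂<⅓ X₂<⅓)))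

  x₁-best : ∀ a → 0ℚ < x₁ a → ½ * Y₂ ≤ (A· y₂) a + η
  x₁-best a 0<x₁a = subst (_≤ (A· y₂) a + η) (Σu·A≡½Σ y₂) (average≤ (A· y₂) _ (rowᴱ≥ᴱ a 0<x₁a))

  y₁-best : ∀ b → 0ℚ < y₁ b → ½ * X₂ ≤ (A· x₂) b + η
  y₁-best b 0<y₁b = subst (_≤ (A· x₂) b + η) (Σu·A≡½Σ x₂) (average≤ (A· x₂) _ (colᴱ≥ᴱ b 0<y₁b))

  played⇒∈S : ∀ {s : Fin n → ℚ} {a} → ½ * Σᶠ n s ≤ (A· s) a + η → ⅓ ≤ Σᶠ n s → mem S a ≡ true
  played⇒∈S {s} {a} best ⅓≤Σs = ¬-not λ a∉S →
    support-loses (subst (λ t → ½ * Σᶠ n s ≤ t + η) (A·-outside s a∉S) best) ⅓≤Σs ε<1/26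

  vanishes-outside : ∀ {z : Fin n → ℚ} → (∀ a → 0ℚ ≤ z a) → (∀ a → 0ℚ < z a → mem S a ≡ true) → VanishesOutside S z
  vanishes-outside z≥0 played⇒∈ a a∉S with pos⊎zero (z≥0 a)
  ... | inj₁ 0<za = contradiction (trans (sym (played⇒∈ a 0<za)) a∉S) λ ()
  ... | inj₂ za≡0 = za≡0

  x₁-support : ∀ a → 0ℚ < x₁ a → mem S a ≡ true
  x₁-support a 0<x₁a = played⇒∈S (x₁-best a 0<x₁a) ⅓≤Y₂

  y₁-support : ∀ b → 0ℚ < y₁ b → mem S b ≡ true
  y₁-support b 0<y₁b = played⇒∈S (y₁-best b 0<y₁b) ⅓≤X₂

  y₂-best : ∀ b → 0ℚ < y₂ b → ∀ b′ → Σ∈ (T b) x₁ ≤ Σ∈ (T b′) x₁ + η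
  y₂-best b 0<y₂b b′ = complement-slack {X₁} {t′ = Σ∈ (T b′) x₁} {η}
    (subst₂ (λ p q → p ≤ q + η) (·B≡Σ-Σ∈T x₁ b′) (·B≡Σ-Σ∈T x₁ b) (colˢ≥ˢ b 0<y₂b b′))

  x₂-best : ∀ b → 0ℚ < x₂ b → ∀ b′ → Σ∈ (T b) y₁ ≤ Σ∈ (T b′) y₁ + η
  x₂-best b 0<x₂b b′ = complement-slack {Y₁} {t′ = Σ∈ (T b′) y₁} {η}
    (subst₂ (λ p q → p ≤ q + η) (·B≡Σ-Σ∈T y₁ b′) (·B≡Σ-Σ∈T y₁ b) (rowˢ≥ˢ b 0<x₂b b′))

  module G₁ = Subgame x₁ y₂ x₁≥0 y₂≥0 (vanishes-outside x₁≥0 x₁-support) s₀ η 0≤η x₁-best y₂-best ⅓≤Y₂ (mass≤⅔ X₁+X₂≡1 ⅓≤X₂)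
  module G₂ = Subgame y₁ x₂ y₁≥0 x₂≥0 (vanishes-outside y₁≥0 y₁-support) s₀ η 0≤η y₁-best x₂-best ⅓≤X₂ (mass≤⅔ Y₁+Y₂≡1 ⅓≤Y₂)

  X₁-upper : X₁ - ½ ≤ + 30 / 1 * ε
  X₁-upper = balance-upper₁ {X₁} {X₂} {Y₂} {G₁.W} X₁+X₂≡1 weighted G₁.W-lower ⅓≤Y₂ (mass≤⅔ X₁+X₂≡1 ⅓≤X₂) 0≤ε
    where
    K = 4ℚ * X₂ - 4ℚ * X₁ + η
    per-subset : ∀ b → 0ℚ < y₂ b → ½ * X₂ ≤ (x₁ ·B) b + K
    per-subset b 0<y₂b = subst (_≤ (x₁ ·B) b + K) (Σu·A≡½Σ x₂)
                           (average≤ (A· x₂) ((x₁ ·B) b + K) (λ k → gain-swap {X₁} {X₂} (colˢ≥ᴱ b 0<y₂b k)))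
    Σy₂·B≡ : Σᶠ n (λ b → y₂ b * (x₁ ·B) b) ≡ Y₂ * X₁ - G₁.W
    Σy₂·B≡ = trans (Σᶠ-cong n (λ b → cong (y₂ b *_) (·B≡Σ-Σ∈T x₁ b))) (Σᶠ-weighted-- y₂ (λ b → Σ∈ (T b) x₁) X₁)
    weighted : Y₂ * (½ * X₂) ≤ (Y₂ * X₁ - G₁.W) + Y₂ * K
    weighted = subst (λ t → Y₂ * (½ * X₂) ≤ t + Y₂ * K) Σy₂·B≡ (Σᶠ-weighted-bound y₂ (x₁ ·B) (½ * X₂) K y₂≥0 per-subset)

  X₁-lower : - (+ 30 / 1 * ε) ≤ X₁ - ½
  X₁-lower = balance-lower₁ {X₁} {X₂} {Y₁} {G₂.W} X₁+X₂≡1 weighted G₂.W-upper-½ ⅓≤Y₁ (mass≤⅔ X₂+X₁≡1 ⅓≤X₁) 0≤ε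
    where
    K = 4ℚ * X₁ - 4ℚ * X₂ + η
    b* = proj₁ G₁.light-subset
    ½X₁≤·B : ½ * X₁ ≤ (x₁ ·B) b*
    ½X₁≤·B = subst (½ * X₁ ≤_) (sym (·B≡Σ-Σ∈T x₁ b*)) (half≤complement {X₁} (proj₂ G₁.light-subset))
    per-element : ∀ b → 0ℚ < y₁ b → ½ * X₁ ≤ (A· x₂) b + K
    per-element b 0<y₁b = ≤-trans ½X₁≤·B (gain-swap {X₂} {X₁} (colᴱ≥ˢ b 0<y₁b b*))
    weighted : Y₁ * (½ * X₁) ≤ G₂.W + Y₁ * K
    weighted = subst (λ t → Y₁ * (½ * X₁) ≤ t + Y₁ * K) (Σe·A≡Σs·Σ∈T y₁ x₂ (vanishes-outside y₁≥0 y₁-support))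
                 (Σᶠ-weighted-bound y₁ (A· x₂) (½ * X₁) K y₁≥0 per-element)

  Y₁-upper : Y₁ - ½ ≤ + 30 / 1 * ε
  Y₁-upper = balance-upper₂ {Y₁} {Y₂} {X₁} {G₁.W} Y₁+Y₂≡1 weighted G₁.W-upper-½ ⅓≤X₁ (mass≤⅔ Y₂+Y₁≡1 ⅓≤Y₁) 0≤ε
    where
    K = 4ℚ * Y₂ - 4ℚ * Y₁ + η
    a* = proj₁ G₂.light-subset
    ½Y₁≤·B : ½ * Y₁ ≤ (y₁ ·B) a*
    ½Y₁≤·B = subst (½ * Y₁ ≤_) (sym (·B≡Σ-Σ∈T y₁ a*)) (half≤complement {Y₁} (proj₂ G₂.light-subset))
    per-element : ∀ a → 0ℚ < x₁ a → ½ * Y₁ ≤ (A· y₂) a + K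
    per-element a 0<x₁a = ≤-trans ½Y₁≤·B (gain-swap {Y₁} {Y₂} (rowᴱ≥ˢ a 0<x₁a a*))
    weighted : X₁ * (½ * Y₁) ≤ G₁.W + X₁ * K
    weighted = subst (λ t → X₁ * (½ * Y₁) ≤ t + X₁ * K) (Σe·A≡Σs·Σ∈T x₁ y₂ (vanishes-outside x₁≥0 x₁-support))
                 (Σᶠ-weighted-bound x₁ (A· y₂) (½ * Y₁) K x₁≥0 per-element)

  Y₁-lower : - (+ 30 / 1 * ε) ≤ Y₁ - ½
  Y₁-lower = balance-lower₂ {Y₁} {Y₂} {X₂} {G₂.W} Y₁+Y₂≡1 weighted G₂.W-lower ⅓≤X₂ (mass≤⅔ Y₁+Y₂≡1 ⅓≤Y₂) 0≤ε
    where
    K = 4ℚ * Y₁ - 4ℚ * Y₂ + η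
    per-subset : ∀ b → 0ℚ < x₂ b → ½ * Y₂ ≤ (y₁ ·B) b + K
    per-subset b 0<x₂b = subst (_≤ (y₁ ·B) b + K) (Σu·A≡½Σ y₂)
                           (average≤ (A· y₂) ((y₁ ·B) b + K) (λ k → gain-swap {Y₂} {Y₁} (rowˢ≥ᴱ b 0<x₂b k)))
    Σx₂·B≡ : Σᶠ n (λ b → x₂ b * (y₁ ·B) b) ≡ X₂ * Y₁ - G₂.W
    Σx₂·B≡ = trans (Σᶠ-cong n (λ b → cong (x₂ b *_) (·B≡Σ-Σ∈T y₁ b))) (Σᶠ-weighted-- x₂ (λ b → Σ∈ (T b) y₁) Y₁)
    weighted : X₂ * (½ * Y₂) ≤ (X₂ * Y₁ - G₂.W) + X₂ * K
    weighted = subst (λ t → X₂ * (½ * Y₂) ≤ t + X₂ * K) Σx₂·B≡ (Σᶠ-weighted-bound x₂ (y₁ ·B) (½ * Y₂) K x₂≥0 per-subset)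

  x₁-near-uniform : Σᶠ n (λ a → abs (x₁ a - ½ * u a)) ≤ + 102 / 1 * ε
  x₁-near-uniform = subst (Σᶠ n (λ a → abs (x₁ a - ½ * u a)) ≤_) (12η+30ε≡102ε ε)
                      (G₁.distance-to-uniform (+ 30 / 1 * ε) (abs≤ X₁-lower X₁-upper))

  y₁-near-uniform : Σᶠ n (λ a → abs (y₁ a - ½ * u a)) ≤ + 102 / 1 * ε
  y₁-near-uniform = subst (Σᶠ n (λ a → abs (y₁ a - ½ * u a)) ≤_) (12η+30ε≡102ε ε)
                      (G₂.distance-to-uniform (+ 30 / 1 * ε) (abs≤ Y₁-lower Y₁-upper))

∣embed∣≡∣S∣ : ∀ {n} (S : Subset n) → ∣ embed S ∣ ≡ ∣ S ∣
∣embed∣≡∣S∣ {n} S = go S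
  where
  go : ∀ {k} (S : Subset k) → ∣ S ++ replicate n outside ∣ ≡ ∣ S ∣
  go []            = ∣⊥∣≡0 n
  go (inside ∷ S)  = cong suc (go S)
  go (outside ∷ S) = go S

uCoord-embed : ∀ {n} (S : Subset n) a → uCoord (embed S) (a ↑ˡ n) ≡ uCoord S a
uCoord-embed {n} S a = cong₂ (λ b k → if b then inv k else 0ℚ) (lookup-++ˡ S (replicate n outside) a) (∣embed∣≡∣S∣ S)

n+t<ᵇn≡false : ∀ n t → ((n ℕ.+ t) ℕ.<ᵇ n) ≡ false
n+t<ᵇn≡false zero    t = refl
n+t<ᵇn≡false (suc n) t = n+t<ᵇn≡false n t

Σ<ᶠ-first-half : ∀ n (f : Fin (n ℕ.+ n) → ℚ) → Σ<ᶠ (n ℕ.+ n) n f ≡ Σᶠ n (λ a → f (a ↑ˡ n))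
Σ<ᶠ-first-half n f = begin
  Σ<ᶠ (n ℕ.+ n) n f
    ≡⟨ Σᶠ-↑ n n _ ⟩
  Σᶠ n (λ a → if toℕ (a ↑ˡ n) ℕ.<ᵇ n then f (a ↑ˡ n) else 0ℚ) + Σᶠ n (λ b → if toℕ (n ↑ʳ b) ℕ.<ᵇ n then f (n ↑ʳ b) else 0ℚ)
    ≡⟨ cong₂ _+_ (Σᶠ-cong n first) (trans (Σᶠ-cong n second) (Σᶠ-zero n)) ⟩
  Σᶠ n (λ a → f (a ↑ˡ n)) + 0ℚ
    ≡⟨ +-identityʳ _ ⟩
  Σᶠ n (λ a → f (a ↑ˡ n)) ∎
  where
  open ≡-Reasoning
  first : ∀ a → (if toℕ (a ↑ˡ n) ℕ.<ᵇ n then f (a ↑ˡ n) else 0ℚ) ≡ f (a ↑ˡ n)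
  first a rewrite toℕ-↑ˡ a n | Equivalence.to T-≡ (ℕ.<⇒<ᵇ (toℕ<n a)) = refl
  second : ∀ b → (if toℕ (n ↑ʳ b) ℕ.<ᵇ n then f (n ↑ʳ b) else 0ℚ) ≡ 0ℚ
  second b rewrite toℕ-↑ʳ n b | n+t<ᵇn≡false n (toℕ b) = refl

Σ<ᶠ-distance-embed : ∀ {n} (S : Subset n) (z : Fin (n ℕ.+ n) → ℚ) →
  Σ<ᶠ (n ℕ.+ n) n (λ i → abs (z i - ½ * uCoord (embed S) i)) ≡ Σᶠ n (λ a → abs (z (a ↑ˡ n) - ½ * uCoord S a))
Σ<ᶠ-distance-embed {n} S z =
  trans (Σ<ᶠ-first-half n _) (Σᶠ-cong n (λ a → cong (λ t → abs (z (a ↑ˡ n) - ½ * t)) (uCoord-embed S a)))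

first-half-support : ∀ {n} (S : Subset n) (z : Fin (n ℕ.+ n) → ℚ) → (∀ i → 0ℚ ≤ z i) →
                     (∀ a → 0ℚ < z (a ↑ˡ n) → mem S a ≡ true) →
                     ∀ i → toℕ i ℕ.< n → z i ≢ 0ℚ → mem (embed S) i ≡ true
first-half-support {n} S z z≥0 played⇒∈S i i<n zi≢0 =
  subst (λ j → mem (embed S) j ≡ true) a↑ˡn≡i (trans (lookup-++ˡ S (replicate n outside) a) (played⇒∈S a 0<z[a↑ˡn]))
  where
  a = fromℕ< i<n
  a↑ˡn≡i : a ↑ˡ n ≡ i
  a↑ˡn≡i = splitAt⁻¹-↑ˡ (splitAt-< n i i<n)
  0<z[a↑ˡn] : 0ℚ < z (a ↑ˡ n)
  0<z[a↑ˡn] with pos⊎zero (z≥0 (a ↑ˡ n))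
  ... | inj₁ 0<z = 0<z
  ... | inj₂ z≡0 = contradiction (subst (λ j → z j ≡ 0ℚ) a↑ˡn≡i z≡0) zi≢0

member : ∀ {n} (S : Subset n) → 0 ℕ.< ∣ S ∣ → ∃ λ a → mem S a ≡ true
member {n} S 0<∣S∣ with nonempty? S
... | yes (a , a∈S) = a , ∈⇒mem a∈S
... | no  empty     = contradiction (subst (0 ℕ.<_) (trans (cong ∣_∣ (Empty-unique empty)) (∣⊥∣≡0 n)) 0<∣S∣) λ ()

module Theorem {n} (m : ℕ) (S : Subset n) (T : Fin n → Subset n)
  (∣S∣≡2m : ∣ S ∣ ≡ m ℕ.+ m) (m≥1 : 1 ℕ.≤ m)
  (T⊆S : ∀ b → T b ⊆ S) (∣T∣≡m : ∀ b → ∣ T b ∣ ≡ m)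
  (T-onto : ∀ U → U ⊆ S → ∣ U ∣ ≡ m → ∃ λ b → T b ≡ U)
  (ε : ℚ) (0≤ε : 0ℚ ≤ ε) (ε<1/26 : ε < + 1 / 26) where

  open Construction n S T
  open Payoffs S T
  open Structure m S T ∣S∣≡2m m≥1 T⊆S ∣T∣≡m T-onto

  s₀∈S : ∃ λ s₀ → mem S s₀ ≡ true
  s₀∈S = member S (subst (0 ℕ.<_) (sym ∣S∣≡2m) (ℕ.≤-trans m≥1 (ℕ.m≤m+n m m)))

  s₀ : Fin n
  s₀ = proj₁ s₀∈S

  half-of-2n : ½ * ℕ→ℚ (n ℕ.+ n) ≡ ℕ→ℚ n
  half-of-2n = trans (cong (½ *_) (ℕ→ℚ-+ n n)) (halve (ℕ→ℚ n))
    where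
    halve : ∀ k → ½ * (k + k) ≡ k
    halve = solve-∀ ℚ-ring

  R-bounded : ∀ i j → - 3ℚ ≤ R i j × R i j ≤ 3ℚ
  R-bounded i j with splitAt n i | splitAt n j
  ... | inj₁ a | inj₂ b = decide-≤ tt , decide-≤ tt
  ... | inj₂ a | inj₁ b = decide-≤ tt , decide-≤ tt
  ... | inj₁ a | inj₁ b with mem S a | mem (T b) a
  ...   | true  | true  = decide-≤ tt , decide-≤ tt
  ...   | true  | false = decide-≤ tt , decide-≤ tt
  ...   | false | _     = decide-≤ tt , decide-≤ tt
  R-bounded i j | inj₂ a | inj₂ b with mem S b | mem (T a) b
  ...   | true  | true  = decide-≤ tt , decide-≤ tt
  ...   | true  | false = decide-≤ tt , decide-≤ tt
  ...   | false | _     = decide-≤ tt , decide-≤ tt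

  C-bounded : ∀ i j → - 3ℚ ≤ C i j × C i j ≤ 3ℚ
  C-bounded i j with splitAt n i | splitAt n j
  ... | inj₁ a | inj₂ b = decide-≤ tt , decide-≤ tt
  ... | inj₂ a | inj₁ b = decide-≤ tt , decide-≤ tt
  ... | inj₁ a | inj₁ b with mem S a | mem (T b) a
  ...   | true  | true  = decide-≤ tt , decide-≤ tt
  ...   | true  | false = decide-≤ tt , decide-≤ tt
  ...   | false | _     = decide-≤ tt , decide-≤ tt
  C-bounded i j | inj₂ a | inj₂ b with mem S b | mem (T a) b
  ...   | true  | true  = decide-≤ tt , decide-≤ tt
  ...   | true  | false = decide-≤ tt , decide-≤ tt
  ...   | false | _     = decide-≤ tt , decide-≤ tt

  entries-bounded : ∀ i j → (- 1ℚ ≤ R̃ i j × R̃ i j ≤ 1ℚ) × (- 1ℚ ≤ C̃ i j × C̃ i j ≤ 1ℚ)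
  entries-bounded i j = uncurry rescaled-entry-bounds (R-bounded i (swapHalf j)) ,
                        uncurry rescaled-entry-bounds (C-bounded i (swapHalf j))

  rescaled : ℚ → ℚ
  rescaled p = (p + 3ℚ) * (+ 1 / 6)

  some-row-earns-½ : ∀ y → Simplex (n ℕ.+ n) y → ∃ λ i → ½ ≤ rowPay R̃ y i
  some-row-earns-½ y (y≥0 , Σy≡1) with Σᶠ n (half₁ y) ≤? Σᶠ n (half₂ y)
  ... | yes Y₁≤Y₂ = s₀ ↑ˡ n , subst (½ ≤_) (sym (trans (rowPay-R̃ y Σy≡1 _) (cong rescaled (Pᵣ-↑ˡ y s₀))))
                                 (½≤rescaled-gain Y₁≤Y₂ (A·-nonNeg (half₂ y) (y≥0 ∘ (n ↑ʳ_)) (proj₂ s₀∈S)))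
  ... | no  Y₁≰Y₂ = n ↑ʳ s₀ , subst (½ ≤_) (sym (trans (rowPay-R̃ y Σy≡1 _) (cong rescaled (Pᵣ-↑ʳ y s₀))))
                                 (½≤rescaled-gain (<⇒≤ (≰⇒> Y₁≰Y₂)) (·B-nonNeg (half₁ y) s₀ (y≥0 ∘ (_↑ˡ n))))

  some-column-earns-½ : ∀ x → Simplex (n ℕ.+ n) x → ∃ λ j → ½ ≤ colPay C̃ x j
  some-column-earns-½ x (x≥0 , Σx≡1) with Σᶠ n (half₂ x) ≤? Σᶠ n (half₁ x)
  ... | yes X₂≤X₁ = s₀ ↑ˡ n , subst (½ ≤_) (sym (trans (colPay-C̃ x Σx≡1 _) (cong rescaled (Qᵣ-↑ˡ x s₀))))
                                 (½≤rescaled-gain X₂≤X₁ (A·-nonNeg (half₂ x) (x≥0 ∘ (n ↑ʳ_)) (proj₂ s₀∈S)))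
  ... | no  X₂≰X₁ = n ↑ʳ s₀ , subst (½ ≤_) (sym (trans (colPay-C̃ x Σx≡1 _) (cong rescaled (Qᵣ-↑ʳ x s₀))))
                                 (½≤rescaled-gain (<⇒≤ (≰⇒> X₂≰X₁)) (·B-nonNeg (half₁ x) s₀ (x≥0 ∘ (_↑ˡ n))))

  equilibria-near-uniform : ∀ x y → IsWNE R̃ C̃ ε x y →
    (∀ i → toℕ i ℕ.< n → x i ≢ 0ℚ → mem (embed S) i ≡ true) ×
    (∀ i → toℕ i ℕ.< n → y i ≢ 0ℚ → mem (embed S) i ≡ true) ×
    (Σ<ᶠ (n ℕ.+ n) n (λ i → abs (x i - ½ * uCoord (embed S) i)) ≤ + 102 / 1 * ε) ×
    (Σ<ᶠ (n ℕ.+ n) n (λ i → abs (y i - ½ * uCoord (embed S) i)) ≤ + 102 / 1 * ε)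
  equilibria-near-uniform x y wne =
    first-half-support S x (proj₁ (proj₁ wne)) E.x₁-support ,
    first-half-support S y (proj₁ (proj₁ (proj₂ wne))) E.y₁-support ,
    subst (_≤ + 102 / 1 * ε) (sym (Σ<ᶠ-distance-embed S x)) E.x₁-near-uniform ,
    subst (_≤ + 102 / 1 * ε) (sym (Σ<ᶠ-distance-embed S y)) E.y₁-near-uniform
    where module E = Equilibrium m S T ∣S∣≡2m m≥1 T⊆S ∣T∣≡m T-onto s₀ (proj₂ s₀∈S) ε 0≤ε ε<1/26 x y wne

mainTheorem20 :
    (m : ℕ) → 1 ℕ.≤ m →
    let l = 2 ℕ.* m
        n = l C m
    in (S : Subset n) → ∣ S ∣ ≡ l →
       (T : Fin n → Subset n) →
       (∀ j → T j ⊆ S × ∣ T j ∣ ≡ m) →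
       (∀ j j′ → T j ≡ T j′ → j ≡ j′) →
       (∀ (U : Subset n) → U ⊆ S → ∣ U ∣ ≡ m → ∃ λ j → T j ≡ U) →
       (ε : ℚ) → 0ℚ ≤ ε → ε < + 1 / 26 →
       EnumHard (n ℕ.+ n) (Construction.R̃ n S T) (Construction.C̃ n S T)
                ε (+ 102 / 1) (+ 1 / 2) n (embed S)
mainTheorem20 m m≥1 S ∣S∣≡2m T T-spec _ T-onto ε 0≤ε ε<1/26 =
  half-of-2n , entries-bounded , some-row-earns-½ , some-column-earns-½ , equilibria-near-uniform
  where
  open Theorem m S T (trans ∣S∣≡2m (cong (m ℕ.+_) (ℕ.+-identityʳ m))) m≥1
                     (proj₁ ∘ T-spec) (proj₂ ∘ T-spec) T-onto ε 0≤ε ε<1/26
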